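{- Let $P=(h_1,\dots,h_k)$ be a partition of $n$ and let $O$ be a symmetric rational outline rectangle associated to $(P,P,P)$ with $O_i(i,i)=h_i^2$ for all $i\in[k]$. Let $A$ be the $k\times k$ array of multisets in which cell $(i,j)$ contains $\lfloor O_l(i,j)\rfloor$ copies of symbol $l$ for each $l\in[k]$, and let $B$ be a $k\times k$ array of multisets with elements from $[k]$ such that, for all $i,j\in[k]$, with $y(i,j)=\sum_{l\in[k]}\{O_l(i,j)\}$: cell $(i,j)$ of $B$ has exactly $y(i,j)$ entries, symbol $j$ occurs exactly $y(i,j)$ times in row $i$ of $B$, and symbol $j$ occurs exactly $y(i,j)$ times in column $i$ of $B$. Then the cell-wise union $A\cup B$ is an outline rectangle associated to $(P,P,P)$ whose cell $(i,i)$ consists of exactly $h_i^2$ copies of symbol $i$ for each $i\in[k]$, and it lifts to a $\mathrm{LS}(h_1\dots h_k)$; in particular a $\mathrm{LS}(h_1\dots h_k)$ exists.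
   Context: $[m]=\{1,\dots,m\}$; $\{x\}=x-\lfloor x\rfloor$. A latin square of order $n$ is an $n\times n$ array on the symbols $[n]$ with each symbol exactly once in each row and column; a subsquare is a sub-array that is itself a latin square; subsquares are disjoint if they share no row, column or symbol. For a partition $(h_1,\dots,h_k)$ of $n$ (with $h_1\ge\dots\ge h_k>0$), a $\mathrm{LS}(h_1\dots h_k)$ (a 2-realization) is a latin square of order $n$ with pairwise disjoint subsquares of orders $h_1,\dots,h_k$. Given partitions $P=(p_1,\dots,p_u)$, $Q=(q_1,\dots,q_v)$, $R=(r_1,\dots,r_t)$ of $n$, an outline rectangle associated to $(P,Q,R)$ is a $u\times v$ array of multisets with elements from $[t]$ such that cell $(i,j)$ has $p_iq_j$ entries, symbol $l$ occurs $p_ir_l$ times in row $i$ and $q_jr_l$ times in column $j$. The reduction modulo $(P,Q,R)$ of a latin square $L$ of order $n$ is the $u\times v$ array of multisets obtained by amalgamating the rows in consecutive blocks of sizes $p_1,\dots,p_u$, the columns in consecutive blocks of sizes $q_1,\dots,q_v$, and mapping the symbols of the $l$-th consecutive block of sizes $r_1,\dots,r_t$ to symbol $l$; an outline rectangle lifts to $L$ if it is the reduction modulo $(P,Q,R)$ of $L$. A rational outline rectangle associated to $(P,Q,R)$ is a family of non-negative rationals $O_l(i,j)$ with $\sum_l O_l(i,j)=p_iq_j$, $\sum_j O_l(i,j)=p_ir_l$, $\sum_i O_l(i,j)=q_jr_l$; it is symmetric if $P=Q=R$ and $O_l(i,j)$ is invariant under all permutations of $(i,j,l)$. -}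

module Defs where

open import Data.Nat as ℕ using (ℕ; zero; suc; _≤ᵇ_; _<ᵇ_)
open import Data.Integer as ℤ using (ℤ; +_)
open import Data.Rational as ℚ using (ℚ; 0ℚ; floor)
open import Data.Fin using (Fin; zero; suc; toℕ)
open import Data.Bool using (Bool; true; false; if_then_else_; _∧_)
open import Data.Product using (Σ; _×_; ∃)
open import Function.Definitions using (Injective)
open import Relation.Binary.PropositionalEquality using (_≡_; _≢_)

sumFin : (n : ℕ) → (Fin n → ℕ) → ℕ
sumFin zero    f = 0
sumFin (suc n) f = f zero ℕ.+ sumFin n (λ i → f (suc i))

sumFinℚ : (n : ℕ) → (Fin n → ℚ) → ℚ
sumFinℚ zero    f = 0ℚ
sumFinℚ (suc n) f = f zero ℚ.+ sumFinℚ n (λ i → f (suc i))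

ℕtoℚ : ℕ → ℚ
ℕtoℚ m = + m ℚ./ 1

frac : ℚ → ℚ
frac x = x ℚ.- (floor x ℚ./ 1)

IsPartition : (n k : ℕ) → (Fin k → ℕ) → Set
IsPartition n k h =
  (∀ i → 0 ℕ.< h i) × (∀ i j → toℕ i ℕ.≤ toℕ j → h j ℕ.≤ h i) × (sumFin k h ≡ n)

-- A k×k array of multisets on [k] is encoded as M i j l = multiplicity of symbol l in cell (i,j).
MultisetArray : ℕ → Set
MultisetArray k = Fin k → Fin k → Fin k → ℕ

IsOutline : (k : ℕ) → (Fin k → ℕ) → MultisetArray k → Set
IsOutline k h M =
  (∀ i j → sumFin k (M i j) ≡ h i ℕ.* h j) ×
  (∀ i l → sumFin k (λ j → M i j l) ≡ h i ℕ.* h l) ×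
  (∀ j l → sumFin k (λ i → M i j l) ≡ h j ℕ.* h l)

-- rational outline rectangle, O i j l stands for O_l(i,j)
IsRationalOutline : (k : ℕ) → (Fin k → ℕ) → (Fin k → Fin k → Fin k → ℚ) → Set
IsRationalOutline k h O =
  (∀ i j l → 0ℚ ℚ.≤ O i j l) ×
  (∀ i j → sumFinℚ k (O i j) ≡ ℕtoℚ (h i ℕ.* h j)) ×
  (∀ i l → sumFinℚ k (λ j → O i j l) ≡ ℕtoℚ (h i ℕ.* h l)) ×
  (∀ j l → sumFinℚ k (λ i → O i j l) ≡ ℕtoℚ (h j ℕ.* h l))

IsSymmetric : (k : ℕ) → (Fin k → Fin k → Fin k → ℚ) → Set
IsSymmetric k O =
  ∀ i j l → (O i j l ≡ O j i l) × (O i j l ≡ O i l j) × (O i j l ≡ O l j i)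
          × (O i j l ≡ O j l i) × (O i j l ≡ O l i j)

-- latin square of order n on symbols Fin n (symbol s ↔ s+1 ∈ [n])
IsLatin : (n : ℕ) → (Fin n → Fin n → Fin n) → Set
IsLatin n L =
  (∀ r s → Σ (Fin n) λ c → (L r c ≡ s) × (∀ c′ → L r c′ ≡ s → c′ ≡ c)) ×
  (∀ c s → Σ (Fin n) λ r → (L r c ≡ s) × (∀ r′ → L r′ c ≡ s → r′ ≡ r))

-- a subsquare of order m: rows Rs, columns Cs, symbols Ss (injective enumerations of
-- m-element subsets of [n]) such that the sub-array is a latin square on the symbols Ss
record Subsquare (n : ℕ) (L : Fin n → Fin n → Fin n) (m : ℕ) : Set where
  field
    rows    : Fin m → Fin n
    cols    : Fin m → Fin n
    syms    : Fin m → Fin n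
    rowsInj : Injective _≡_ _≡_ rows
    colsInj : Injective _≡_ _≡_ cols
    symsInj : Injective _≡_ _≡_ syms
    sub     : Fin m → Fin m → Fin m
    subLatin : IsLatin m sub
    subEq   : ∀ a b → L (rows a) (cols b) ≡ syms (sub a b)

Disjoint : ∀ {n m m′} {L : Fin n → Fin n → Fin n} → Subsquare n L m → Subsquare n L m′ → Set
Disjoint S T =
  (∀ a b → Subsquare.rows S a ≢ Subsquare.rows T b) ×
  (∀ a b → Subsquare.cols S a ≢ Subsquare.cols T b) ×
  (∀ a b → Subsquare.syms S a ≢ Subsquare.syms T b)

IsLSRealization : (n k : ℕ) → (Fin k → ℕ) → (Fin n → Fin n → Fin n) → Set
IsLSRealization n k h L =
  IsLatin n L ×
  Σ ((i : Fin k) → Subsquare n L (h i)) λ S → ∀ i j → i ≢ j → Disjoint (S i) (S j)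

offset : (k : ℕ) → (Fin k → ℕ) → Fin k → ℕ
offset k h i = sumFin k (λ j → if toℕ j <ᵇ toℕ i then h j else 0)

inBlock : ∀ {n} (k : ℕ) → (Fin k → ℕ) → Fin k → Fin n → Bool
inBlock k h i x = (offset k h i ≤ᵇ toℕ x) ∧ (toℕ x <ᵇ offset k h i ℕ.+ h i)

reduction : (n k : ℕ) → (Fin k → ℕ) → (Fin n → Fin n → Fin n) → MultisetArray k
reduction n k h L i j l =
  sumFin n λ r → sumFin n λ c →
    if inBlock k h i r ∧ inBlock k h j c ∧ inBlock k h l (L r c) then 1 else 0

LiftsTo : (n k : ℕ) → (Fin k → ℕ) → MultisetArray k → (Fin n → Fin n → Fin n) → Set
LiftsTo n k h M L = ∀ i j l → reduction n k h L i j l ≡ M i j l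

-- Writing each O_l(i,j) as its floor plus its fractional part, the hypotheses on B say exactly
-- that B restores the fractional parts dropped by A, so A ∪ B is an integral outline; its entry
-- h_i² at symbol i of cell (i,i) uses up that cell and the quota of symbol i in row i and in
-- column i.
-- An integral outline lifts to a latin square by splitting, in turn, each block of rows,
-- of columns and of symbols of size h into h single ones. Splitting a block means writing a
-- matrix with margins h·q and h·r as a sum of h matrices with margins q and r; each summand is
-- found by Gale's supply–demand theorem, proved by induction on the total supply, using that
-- tight cuts are closed under union.
-- In the lifted square the pure diagonal forces block i × block i to be filled with the
-- symbols of block i, so the blocks are pairwise disjoint subsquares.
{-# OPTIONS --safe #-}
module Submission where

open import Defs
open import Data.Nat using (ℕ; _+_; _*_)
open import Data.Integer using (∣_∣)
open import Data.Rational using (ℚ; floor)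
open import Data.Fin using (Fin)
open import Data.Product using (Σ; _×_)
open import Relation.Binary.PropositionalEquality using (_≡_; _≢_)

open import Data.Nat as ℕ using (zero; suc; _∸_; _≤_; _<_; _≤ᵇ_; _<ᵇ_; z≤n; s≤s; s≤s⁻¹; _<?_)
open import Data.Nat.Properties
open import Data.Nat.DivMod using (n/1≡n)
open import Data.Nat.Coprimality as Coprimality using (Coprime)
open import Data.Nat.Tactic.RingSolver using (solve-∀)
open import Data.Integer as ℤ using (-[1+_])
open import Data.Integer.Properties as ℤP using ()
open import Data.Rational as ℚ using (mkℚ; 0ℚ; ↥_)
open import Data.Rational.Properties as ℚP using ()
open import Data.Fin as F using (zero; suc; toℕ; fromℕ<)
open import Data.Fin.Properties using (toℕ-injective; toℕ<n; toℕ-fromℕ<; any?)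
open import Data.Fin.Subset.Properties using (anySubset?)
open import Data.Vec using (lookup; tabulate)
open import Data.Vec.Properties using (lookup∘tabulate)
open import Data.Bool using (Bool; true; false; if_then_else_; _∧_; _∨_; not)
open import Data.Bool.Properties using (∨-zeroʳ; ∨-identityʳ; T-≡; T-∧)
open import Data.Product using (∃; ∃₂; _,_; proj₁; proj₂)
open import Data.Sum using (_⊎_; inj₁; inj₂)
open import Data.Empty using (⊥; ⊥-elim)
open import Relation.Nullary using (Dec; yes; no; ¬_)
open import Relation.Nullary.Decidable using (isYes; map′; _×-dec_; ¬?)
open import Relation.Binary using (tri<; tri≈; tri>)
open import Relation.Binary.PropositionalEquality using (refl; sym; trans; cong; cong₂; subst; subst₂; module ≡-Reasoning)
open import Function using (_∘_; Equivalence)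
open import Algebra.Properties.CommutativeMonoid.Sum +-0-commutativeMonoid using (sum; ∑-distrib-+; ∑-comm)
open import Algebra.Properties.Semiring.Sum +-*-semiring using (*-distribˡ-sum)
import Algebra.Properties.CommutativeMonoid.Sum ℚP.+-0-commutativeMonoid as ℚ∑

open Equivalence using (to; from)

when : Bool → ℕ → ℕ
when b x = if b then x else 0

when-+ : ∀ b x y → when b (x + y) ≡ when b x + when b y
when-+ true  x y = refl
when-+ false x y = refl

when-comm : ∀ a b x → when a (when b x) ≡ when b (when a x)
when-comm true  b     x = refl
when-comm false true  x = refl
when-comm false false x = refl

when-*ʳ : ∀ b p x → when b (p * x) ≡ p * when b x
when-*ʳ true  p x = refl
when-*ʳ false p x = sym (*-zeroʳ p)

when-zero : ∀ b → when b 0 ≡ 0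
when-zero true  = refl
when-zero false = refl

when≤ : ∀ b x → when b x ≤ x
when≤ true  x = ≤-refl
when≤ false x = z≤n

when-cong : ∀ b {x y} → (b ≡ true → x ≡ y) → when b x ≡ when b y
when-cong true  eq = eq refl
when-cong false eq = refl

_≡ᵇ_ : ∀ {n} → Fin n → Fin n → Bool
x ≡ᵇ y = isYes (x F.≟ y)

≡ᵇ-refl : ∀ {n} (x : Fin n) → (x ≡ᵇ x) ≡ true
≡ᵇ-refl x with x F.≟ x
... | yes _   = refl
... | no  x≢x = ⊥-elim (x≢x refl)

δ : ∀ {n} → Fin n → Fin n → ℕ
δ x i = when (i ≡ᵇ x) 1

δ≤ : ∀ {n} (x : Fin n) {f : Fin n → ℕ} → 0 < f x → ∀ i → δ x i ≤ f i
δ≤ x 0<fx i with i F.≟ x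
... | yes refl = 0<fx
... | no  _    = z≤n

sumFin≗sum : ∀ n (f : Fin n → ℕ) → sumFin n f ≡ sum f
sumFin≗sum zero    f = refl
sumFin≗sum (suc n) f = cong (f zero +_) (sumFin≗sum n (f ∘ suc))

sumFin-cong : ∀ n {f g : Fin n → ℕ} → (∀ i → f i ≡ g i) → sumFin n f ≡ sumFin n g
sumFin-cong zero    f≗g = refl
sumFin-cong (suc n) f≗g = cong₂ _+_ (f≗g zero) (sumFin-cong n (f≗g ∘ suc))

sumFin-zero : ∀ n → sumFin n (λ _ → 0) ≡ 0
sumFin-zero zero    = refl
sumFin-zero (suc n) = sumFin-zero n

sumFin-+ : ∀ n (f g : Fin n → ℕ) → sumFin n (λ i → f i + g i) ≡ sumFin n f + sumFin n g
sumFin-+ n f g = begin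
  sumFin n (λ i → f i + g i) ≡⟨ sumFin≗sum n _ ⟩
  sum (λ i → f i + g i)      ≡⟨ ∑-distrib-+ f g ⟩
  sum f + sum g              ≡⟨ sym (cong₂ _+_ (sumFin≗sum n f) (sumFin≗sum n g)) ⟩
  sumFin n f + sumFin n g    ∎
  where open ≡-Reasoning

sumFin-*ˡ : ∀ n p (f : Fin n → ℕ) → sumFin n (λ i → p * f i) ≡ p * sumFin n f
sumFin-*ˡ n p f = begin
  sumFin n (λ i → p * f i) ≡⟨ sumFin≗sum n _ ⟩
  sum (λ i → p * f i)      ≡⟨ sym (*-distribˡ-sum p f) ⟩
  p * sum f                ≡⟨ sym (cong (p *_) (sumFin≗sum n f)) ⟩
  p * sumFin n f           ∎
  where open ≡-Reasoning

sumFin-comm : ∀ m n (f : Fin m → Fin n → ℕ) →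
  sumFin m (λ i → sumFin n (f i)) ≡ sumFin n (λ j → sumFin m (λ i → f i j))
sumFin-comm m n f = begin
  sumFin m (λ i → sumFin n (f i))           ≡⟨ sumFin-cong m (λ i → sumFin≗sum n (f i)) ⟩
  sumFin m (λ i → sum (f i))                ≡⟨ sumFin≗sum m _ ⟩
  sum (λ i → sum (f i))                     ≡⟨ ∑-comm f ⟩
  sum (λ j → sum (λ i → f i j))             ≡⟨ sym (sumFin≗sum n _) ⟩
  sumFin n (λ j → sum (λ i → f i j))        ≡⟨ sumFin-cong n (λ j → sym (sumFin≗sum m _)) ⟩
  sumFin n (λ j → sumFin m (λ i → f i j))   ∎
  where open ≡-Reasoning

sumFin-mono : ∀ n {f g : Fin n → ℕ} → (∀ i → f i ≤ g i) → sumFin n f ≤ sumFin n g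
sumFin-mono zero    f≤g = z≤n
sumFin-mono (suc n) f≤g = +-mono-≤ (f≤g zero) (sumFin-mono n (f≤g ∘ suc))

sumFin-when : ∀ n b (f : Fin n → ℕ) → sumFin n (λ i → when b (f i)) ≡ when b (sumFin n f)
sumFin-when n true  f = refl
sumFin-when n false f = sumFin-zero n

sumFin-pick : ∀ n (x : Fin n) (g : Fin n → ℕ) → sumFin n (λ i → when (i ≡ᵇ x) (g i)) ≡ g x
sumFin-pick (suc n) zero    g = trans (cong (g zero +_) (sumFin-zero n)) (+-identityʳ _)
sumFin-pick (suc n) (suc x) g = trans (sumFin-cong n shift) (sumFin-pick n x (g ∘ suc))
  where
  shift : ∀ i → when (suc i ≡ᵇ suc x) (g (suc i)) ≡ when (i ≡ᵇ x) (g (suc i))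
  shift i with i F.≟ x
  ... | yes _ = refl
  ... | no  _ = refl

sumFin-δ : ∀ n (x : Fin n) → sumFin n (δ x) ≡ 1
sumFin-δ n x = sumFin-pick n x (λ _ → 1)

term≤sumFin : ∀ n (f : Fin n → ℕ) x → f x ≤ sumFin n f
term≤sumFin (suc n) f zero    = m≤m+n _ _
term≤sumFin (suc n) f (suc x) = ≤-trans (term≤sumFin n (f ∘ suc) x) (m≤n+m _ _)

sumFin≡0⇒≡0 : ∀ n (f : Fin n → ℕ) → sumFin n f ≡ 0 → ∀ i → f i ≡ 0
sumFin≡0⇒≡0 n f Σf≡0 i = n≤0⇒n≡0 (subst (f i ≤_) Σf≡0 (term≤sumFin n f i))

sumFin>0⇒>0 : ∀ n (f : Fin n → ℕ) → 0 < sumFin n f → ∃ λ i → 0 < f i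
sumFin>0⇒>0 (suc n) f 0<Σf with f zero ℕ.≟ 0
... | no  f0≢0 = zero , n≢0⇒n>0 f0≢0
... | yes f0≡0 with sumFin>0⇒>0 n (f ∘ suc) (subst (λ a → 0 < a + sumFin n (f ∘ suc)) f0≡0 0<Σf)
...   | i , 0<fi = suc i , 0<fi

sumFin-∸ : ∀ n (f g : Fin n → ℕ) → (∀ i → g i ≤ f i) →
  sumFin n (λ i → f i ∸ g i) + sumFin n g ≡ sumFin n f
sumFin-∸ n f g g≤f = trans (sym (sumFin-+ n _ _)) (sumFin-cong n (λ i → m∸n+n≡m (g≤f i)))

sumFin≡term⇒≡0 : ∀ n (f : Fin n → ℕ) x → sumFin n f ≡ f x → ∀ y → y ≢ x → f y ≡ 0
sumFin≡term⇒≡0 n f x Σf≡fx y y≢x with y F.≟ x | sumFin≡0⇒≡0 n _ others≡0 y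
  where
  split : sumFin n f ≡ f x + sumFin n (λ i → when (not (i ≡ᵇ x)) (f i))
  split = trans (sumFin-cong n (λ i → sym (pick+rest (i ≡ᵇ x) (f i))))
         (trans (sumFin-+ n _ _) (cong (_+ sumFin n (λ i → when (not (i ≡ᵇ x)) (f i))) (sumFin-pick n x f)))
    where
    pick+rest : ∀ b a → when b a + when (not b) a ≡ a
    pick+rest true  a = +-identityʳ a
    pick+rest false a = refl
  others≡0 : sumFin n (λ i → when (not (i ≡ᵇ x)) (f i)) ≡ 0
  others≡0 = +-cancelˡ-≡ (f x) _ 0 (trans (sym split) (trans Σf≡fx (sym (+-identityʳ _))))
... | yes y≡x | _   = ⊥-elim (y≢x y≡x)
... | no  _   | fy≡0 = fy≡0

sumFin≡1⇒δ : ∀ n (f : Fin n → ℕ) → sumFin n f ≡ 1 → Σ (Fin n) λ x → ∀ y → f y ≡ δ x y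
sumFin≡1⇒δ n f Σf≡1 with sumFin>0⇒>0 n f (subst (0 <_) (sym Σf≡1) (s≤s z≤n))
... | x , 0<fx = x , f≗δx
  where
  fx≡1 : f x ≡ 1
  fx≡1 = ≤-antisym (subst (f x ≤_) Σf≡1 (term≤sumFin n f x)) 0<fx
  f≗δx : ∀ y → f y ≡ δ x y
  f≗δx y with y F.≟ x
  ... | yes refl = fx≡1
  ... | no  y≢x  = sumFin≡term⇒≡0 n f x (trans Σf≡1 (sym fx≡1)) y y≢x

δ-self : ∀ {n} (x : Fin n) → δ x x ≡ 1
δ-self x = cong (λ b → when b 1) (≡ᵇ-refl x)

δ≡1⇒≡ : ∀ {n} {x y : Fin n} → δ x y ≡ 1 → y ≡ x
δ≡1⇒≡ {x = x} {y} δxy≡1 with y F.≟ x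
... | yes y≡x = y≡x
δ≡1⇒≡ () | no _

sumFin≡1⇒∃! : ∀ n (f : Fin n → ℕ) → sumFin n f ≡ 1 → Σ (Fin n) λ x → f x ≡ 1 × (∀ y → f y ≡ 1 → y ≡ x)
sumFin≡1⇒∃! n f Σf≡1 =
  let x , f≗δx = sumFin≡1⇒δ n f Σf≡1
  in x , trans (f≗δx x) (δ-self x) , λ y fy≡1 → δ≡1⇒≡ (trans (sym (f≗δx y)) fy≡1)

sumFin-decrement : ∀ n (f : Fin n → ℕ) x → 0 < f x → ∀ {N} → sumFin n f ≡ suc N →
  sumFin n (λ i → f i ∸ δ x i) ≡ N
sumFin-decrement n f x 0<fx Σf≡1+N = suc-injective (begin
  suc (sumFin n f⁻)           ≡⟨ +-comm 1 _ ⟩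
  sumFin n f⁻ + 1             ≡⟨ cong (sumFin n f⁻ +_) (sym (sumFin-δ n x)) ⟩
  sumFin n f⁻ + sumFin n (δ x) ≡⟨ sumFin-∸ n f (δ x) (δ≤ x 0<fx) ⟩
  sumFin n f                  ≡⟨ Σf≡1+N ⟩
  suc _                       ∎)
  where
  open ≡-Reasoning
  f⁻ : Fin n → ℕ
  f⁻ i = f i ∸ δ x i

sumOver : ∀ n → (Fin n → Bool) → (Fin n → ℕ) → ℕ
sumOver n J f = sumFin n (λ i → when (J i) (f i))

sumOver-cong : ∀ n {J J′ : Fin n → Bool} {f g : Fin n → ℕ} →
  (∀ i → J i ≡ J′ i) → (∀ i → f i ≡ g i) → sumOver n J f ≡ sumOver n J′ g
sumOver-cong n J≗J′ f≗g = sumFin-cong n (λ i → cong₂ when (J≗J′ i) (f≗g i))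

sumOver-+ : ∀ n J (f g : Fin n → ℕ) → sumOver n J (λ i → f i + g i) ≡ sumOver n J f + sumOver n J g
sumOver-+ n J f g = trans (sumFin-cong n (λ i → when-+ (J i) (f i) (g i))) (sumFin-+ n _ _)

sumOver-*ˡ : ∀ n J p (f : Fin n → ℕ) → sumOver n J (λ i → p * f i) ≡ p * sumOver n J f
sumOver-*ˡ n J p f = trans (sumFin-cong n (λ i → when-*ʳ (J i) p (f i))) (sumFin-*ˡ n p _)

sumOver-none : ∀ n (f : Fin n → ℕ) → sumOver n (λ _ → false) f ≡ 0
sumOver-none n f = sumFin-zero n

sumOver-pick : ∀ n J (x : Fin n) (g : Fin n → ℕ) →
  sumOver n J (λ i → when (i ≡ᵇ x) (g i)) ≡ when (J x) (g x)
sumOver-pick n J x g =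
  trans (sumFin-cong n (λ i → when-comm (J i) _ (g i))) (sumFin-pick n x (λ i → when (J i) (g i)))

sumOver≤sumFin : ∀ n J (f : Fin n → ℕ) → sumOver n J f ≤ sumFin n f
sumOver≤sumFin n J f = sumFin-mono n (λ i → when≤ (J i) (f i))

sumOver-compl : ∀ n J (f : Fin n → ℕ) → sumOver n (not ∘ J) f + sumOver n J f ≡ sumFin n f
sumOver-compl n J f = trans (sym (sumFin-+ n _ _)) (sumFin-cong n (λ i → split (J i) (f i)))
  where
  split : ∀ b x → when (not b) x + when b x ≡ x
  split true  x = refl
  split false x = +-identityʳ x

sumOver-∨-∧ : ∀ n J₁ J₂ (f : Fin n → ℕ) →
  sumOver n (λ i → J₁ i ∨ J₂ i) f + sumOver n (λ i → J₁ i ∧ J₂ i) f ≡ sumOver n J₁ f + sumOver n J₂ f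
sumOver-∨-∧ n J₁ J₂ f =
  trans (sym (sumFin-+ n _ _)) (trans (sumFin-cong n (λ i → modular (J₁ i) (J₂ i) (f i))) (sumFin-+ n _ _))
  where
  modular : ∀ a b x → when (a ∨ b) x + when (a ∧ b) x ≡ when a x + when b x
  modular true  true  x = refl
  modular true  false x = refl
  modular false true  x = +-identityʳ x
  modular false false x = refl

sumOver-insert : ∀ n J x → J x ≡ false → (f : Fin n → ℕ) →
  sumOver n (λ i → J i ∨ (i ≡ᵇ x)) f ≡ sumOver n J f + f x
sumOver-insert n J x x∉J f =
  trans (sumFin-cong n split) (trans (sumFin-+ n _ _) (cong (sumOver n J f +_) (sumFin-pick n x f)))
  where
  split : ∀ i → when (J i ∨ (i ≡ᵇ x)) (f i) ≡ when (J i) (f i) + when (i ≡ᵇ x) (f i)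
  split i with i F.≟ x
  ... | yes refl rewrite x∉J = refl
  ... | no  _    rewrite ∨-identityʳ (J i) = sym (+-identityʳ _)

sumOver-when : ∀ n J b (f : Fin n → ℕ) → sumOver n J (λ i → when b (f i)) ≡ when b (sumOver n J f)
sumOver-when n J b f = trans (sumFin-cong n (λ i → when-comm (J i) b (f i))) (sumFin-when n b _)

sumOver-decrement : ∀ n J (f : Fin n → ℕ) x → 0 < f x →
  sumOver n J (λ i → f i ∸ δ x i) + when (J x) 1 ≡ sumOver n J f
sumOver-decrement n J f x 0<fx = begin
  sumOver n J (λ i → f i ∸ δ x i) + when (J x) 1      ≡⟨ cong (sumOver n J _ +_) (sym (sumOver-pick n J x (λ _ → 1))) ⟩
  sumOver n J (λ i → f i ∸ δ x i) + sumOver n J (δ x) ≡⟨ sym (sumOver-+ n J _ _) ⟩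
  sumOver n J (λ i → f i ∸ δ x i + δ x i)             ≡⟨ sumOver-cong n (λ _ → refl) (λ i → m∸n+n≡m (δ≤ x 0<fx i)) ⟩
  sumOver n J f                                       ∎
  where open ≡-Reasoning

-- Gale's supply–demand theorem

⋃ : ∀ {m n} → (Fin m → Fin n → Bool) → Fin n → Bool
⋃ {zero}  J x = false
⋃ {suc m} J x = J zero x ∨ ⋃ (J ∘ suc) x

⋃-⁺ : ∀ {m n} (J : Fin m → Fin n → Bool) t x → J t x ≡ true → ⋃ J x ≡ true
⋃-⁺ J zero    x x∈Jt rewrite x∈Jt = refl
⋃-⁺ J (suc t) x x∈Jt rewrite ⋃-⁺ (J ∘ suc) t x x∈Jt = ∨-zeroʳ (J zero x)

⋃-⁻ : ∀ {m n} (J : Fin m → Fin n → Bool) x → (∀ t → J t x ≡ false) → ⋃ J x ≡ false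
⋃-⁻ {zero}  J x x∉J = refl
⋃-⁻ {suc m} J x x∉J rewrite x∉J zero = ⋃-⁻ (J ∘ suc) x (x∉J ∘ suc)

when-submodular : ∀ a₁ a₂ l₁ l₂ m →
  when (a₁ ∨ a₂) (when (not (l₁ ∨ l₂)) m) + when (a₁ ∧ a₂) (when (not (l₁ ∧ l₂)) m)
    ≤ when a₁ (when (not l₁) m) + when a₂ (when (not l₂) m)
when-submodular true  true  true  true  m = z≤n
when-submodular true  true  true  false m = ≤-refl
when-submodular true  true  false true  m = ≤-reflexive (sym (+-identityʳ m))
when-submodular true  true  false false m = ≤-refl
when-submodular true  false true  true  m = z≤n
when-submodular true  false true  false m = z≤n
when-submodular true  false false true  m = z≤n
when-submodular true  false false false m = ≤-refl
when-submodular false true  true  true  m = z≤n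
when-submodular false true  true  false m = z≤n
when-submodular false true  false true  m = z≤n
when-submodular false true  false false m = ≤-reflexive (+-identityʳ m)
when-submodular false false l₁    l₂    m = z≤n

-- a, d and k are the supply of J, the demand of L and the capacity of the cut (J, L); the primed
-- values are those after removing a unit at (row, column), where x says row ∈ J and y column ∈ L.
decrement-violation : ∀ (x y : Bool) {a a′ d d′ k k′ : ℕ} →
  a′ + when x 1 ≡ a → d′ + when y 1 ≡ d → k′ + when x (when (not y) 1) ≡ k →
  k′ + d′ < a′ → a ≤ k + d → a ≡ k + d × x ≡ false × y ≡ true
decrement-violation true true {a′ = a′} {d′ = d′} {k′ = k′} refl refl refl k′+d′<a′ a≤k+d =
  ⊥-elim (<⇒≱ k′+d′<a′ (s≤s⁻¹ (subst₂ _≤_ (+-comm a′ 1) (shuffle k′ d′) a≤k+d)))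
  where
  shuffle : ∀ k′ d′ → k′ + 0 + (d′ + 1) ≡ 1 + (k′ + d′)
  shuffle = solve-∀
decrement-violation true false {a′ = a′} {d′ = d′} {k′ = k′} refl refl refl k′+d′<a′ a≤k+d =
  ⊥-elim (<⇒≱ k′+d′<a′ (s≤s⁻¹ (subst₂ _≤_ (+-comm a′ 1) (shuffle k′ d′) a≤k+d)))
  where
  shuffle : ∀ k′ d′ → k′ + 1 + (d′ + 0) ≡ 1 + (k′ + d′)
  shuffle = solve-∀
decrement-violation false false {a′ = a′} {d′ = d′} {k′ = k′} refl refl refl k′+d′<a′ a≤k+d =
  ⊥-elim (<⇒≱ k′+d′<a′ (subst₂ _≤_ (+-identityʳ a′) (shuffle k′ d′) a≤k+d))
  where
  shuffle : ∀ k′ d′ → k′ + 0 + (d′ + 0) ≡ k′ + d′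
  shuffle = solve-∀
decrement-violation false true {a′ = a′} {d′ = d′} {k′ = k′} refl refl refl k′+d′<a′ a≤k+d =
  ≤-antisym a≤k+d (≤-trans (≤-reflexive (shuffle k′ d′)) (≤-trans k′+d′<a′ (≤-reflexive (sym (+-identityʳ a′))))) , refl , refl
  where
  shuffle : ∀ k′ d′ → k′ + 0 + (d′ + 1) ≡ suc (k′ + d′)
  shuffle = solve-∀

module Transportation (b c : ℕ) where

  cut : (Fin b → Fin c → ℕ) → (Fin b → Bool) → (Fin c → Bool) → ℕ
  cut M J L = sumOver b J (λ j → sumOver c (not ∘ L) (M j))

  -- Gale's supply–demand condition: the supply u of the rows in J can only be absorbed
  -- by the demand v of the columns in L or through capacity M into the columns outside L.
  GaleCondition : (Fin b → Fin c → ℕ) → (Fin b → ℕ) → (Fin c → ℕ) → Set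
  GaleCondition M u v = ∀ J L → sumOver b J u ≤ cut M J L + sumOver c L v

  Tight : (Fin b → Fin c → ℕ) → (Fin b → ℕ) → (Fin c → ℕ) → (Fin b → Bool) → (Fin c → Bool) → Set
  Tight M u v J L = sumOver b J u ≡ cut M J L + sumOver c L v

  Violates : (Fin b → Fin c → ℕ) → (Fin b → ℕ) → (Fin c → ℕ) → (Fin b → Bool) → (Fin c → Bool) → Set
  Violates M u v J L = cut M J L + sumOver c L v < sumOver b J u

  Violation : (Fin b → Fin c → ℕ) → (Fin b → ℕ) → (Fin c → ℕ) → Set
  Violation M u v = ∃₂ (Violates M u v)

  Transport : (Fin b → Fin c → ℕ) → (Fin b → ℕ) → (Fin c → ℕ) → Set
  Transport M u v = Σ (Fin b → Fin c → ℕ) λ X → (∀ j l → X j l ≤ M j l) ×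
    (∀ j → sumFin c (X j) ≡ u j) × (∀ l → sumFin b (λ j → X j l) ≡ v l)

  cut-cong : ∀ M {J J′ L L′} → (∀ j → J j ≡ J′ j) → (∀ l → L l ≡ L′ l) → cut M J L ≡ cut M J′ L′
  cut-cong M J≗J′ L≗L′ = sumOver-cong b J≗J′ (λ j → sumOver-cong c (cong not ∘ L≗L′) (λ _ → refl))

  cut-+ : ∀ M N J L → cut (λ j l → M j l + N j l) J L ≡ cut M J L + cut N J L
  cut-+ M N J L = trans (sumOver-cong b (λ _ → refl) (λ j → sumOver-+ c (not ∘ L) (M j) (N j))) (sumOver-+ b J _ _)

  cut-submodular : ∀ M J₁ J₂ L₁ L₂ →
    cut M (λ j → J₁ j ∨ J₂ j) (λ l → L₁ l ∨ L₂ l) + cut M (λ j → J₁ j ∧ J₂ j) (λ l → L₁ l ∧ L₂ l)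
      ≤ cut M J₁ L₁ + cut M J₂ L₂
  cut-submodular M J₁ J₂ L₁ L₂ = begin
    cut M _ _ + cut M _ _     ≡⟨ cong₂ _+_ (cut-as-double-sum _ _) (cut-as-double-sum _ _) ⟩
    _                         ≡⟨ sym (sumFin-+ b _ _) ⟩
    _                         ≡⟨ sumFin-cong b (λ j → sym (sumFin-+ c _ _)) ⟩
    _                         ≤⟨ sumFin-mono b (λ j → sumFin-mono c (λ l →
                                   when-submodular (J₁ j) (J₂ j) (L₁ l) (L₂ l) (M j l))) ⟩
    _                         ≡⟨ sumFin-cong b (λ j → sumFin-+ c _ _) ⟩
    _                         ≡⟨ sumFin-+ b _ _ ⟩
    _                         ≡⟨ sym (cong₂ _+_ (cut-as-double-sum J₁ L₁) (cut-as-double-sum J₂ L₂)) ⟩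
    cut M J₁ L₁ + cut M J₂ L₂ ∎
    where
    open ≤-Reasoning
    cut-as-double-sum : ∀ J L → cut M J L ≡ sumFin b (λ j → sumFin c (λ l → when (J j) (when (not (L l)) (M j l))))
    cut-as-double-sum J L = sumFin-cong b (λ j → sym (sumFin-when c (J j) _))

  tight-∪ : ∀ M u v → GaleCondition M u v → ∀ {J₁ L₁ J₂ L₂} → Tight M u v J₁ L₁ → Tight M u v J₂ L₂ →
    Tight M u v (λ j → J₁ j ∨ J₂ j) (λ l → L₁ l ∨ L₂ l)
  tight-∪ M u v gale {J₁} {L₁} {J₂} {L₂} tight₁ tight₂ =
    ≤-antisym (gale J∪ L∪) (+-cancelʳ-≤ (sumOver b J∩ u) _ _ (begin
      (cut M J∪ L∪ + sumOver c L∪ v) + sumOver b J∩ u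
        ≤⟨ +-monoʳ-≤ _ (gale J∩ L∩) ⟩
      (cut M J∪ L∪ + sumOver c L∪ v) + (cut M J∩ L∩ + sumOver c L∩ v)
        ≡⟨ +-exch (cut M J∪ L∪) _ _ _ ⟩
      (cut M J∪ L∪ + cut M J∩ L∩) + (sumOver c L∪ v + sumOver c L∩ v)
        ≤⟨ +-mono-≤ (cut-submodular M J₁ J₂ L₁ L₂) (≤-reflexive (sumOver-∨-∧ c L₁ L₂ v)) ⟩
      (cut M J₁ L₁ + cut M J₂ L₂) + (sumOver c L₁ v + sumOver c L₂ v)
        ≡⟨ +-exch (cut M J₁ L₁) _ _ _ ⟩
      (cut M J₁ L₁ + sumOver c L₁ v) + (cut M J₂ L₂ + sumOver c L₂ v)
        ≡⟨ sym (cong₂ _+_ tight₁ tight₂) ⟩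
      sumOver b J₁ u + sumOver b J₂ u
        ≡⟨ sym (sumOver-∨-∧ b J₁ J₂ u) ⟩
      sumOver b J∪ u + sumOver b J∩ u ∎))
    where
    open ≤-Reasoning
    J∪ = λ j → J₁ j ∨ J₂ j
    J∩ = λ j → J₁ j ∧ J₂ j
    L∪ = λ l → L₁ l ∨ L₂ l
    L∩ = λ l → L₁ l ∧ L₂ l
    +-exch : ∀ p q r s → p + q + (r + s) ≡ p + r + (q + s)
    +-exch = solve-∀

  tight-∅ : ∀ M u v L → sumOver c L v ≡ 0 → Tight M u v (λ _ → false) L
  tight-∅ M u v L ΣLv≡0 = trans (sumOver-none b u) (sym (cong₂ _+_ (sumOver-none b (λ j → sumOver c (not ∘ L) (M j))) ΣLv≡0))

  tight-⋃ : ∀ M u v → GaleCondition M u v → ∀ {m} (J : Fin m → Fin b → Bool) (L : Fin m → Fin c → Bool) →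
    (∀ t → Tight M u v (J t) (L t)) → Tight M u v (⋃ J) (⋃ L)
  tight-⋃ M u v gale {zero}  J L tight = tight-∅ M u v (λ _ → false) (sumOver-none c v)
  tight-⋃ M u v gale {suc m} J L tight =
    tight-∪ M u v gale (tight zero) (tight-⋃ M u v gale (J ∘ suc) (L ∘ suc) (tight ∘ suc))

  violates-resp : ∀ {M u v J J′ L L′} → (∀ j → J j ≡ J′ j) → (∀ l → L l ≡ L′ l) →
    Violates M u v J L → Violates M u v J′ L′
  violates-resp {M} {u} {v} J≗J′ L≗L′ =
    subst₂ _<_ (cong₂ _+_ (cut-cong M J≗J′ L≗L′) (sumOver-cong c L≗L′ (λ _ → refl)))
               (sumOver-cong b J≗J′ (λ _ → refl))

  violation? : ∀ M u v → Dec (Violation M u v)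
  violation? M u v = map′
    (λ { (JV , LV , violates) → lookup JV , lookup LV , violates })
    (λ { (J , L , violates) → tabulate J , tabulate L ,
           violates-resp (sym ∘ lookup∘tabulate J) (sym ∘ lookup∘tabulate L) violates })
    (anySubset? λ JV → anySubset? λ LV →
      cut M (lookup JV) (lookup LV) + sumOver c (lookup LV) v <? sumOver b (lookup JV) u)

  ¬violation⇒gale : ∀ {M u v} → ¬ Violation M u v → GaleCondition M u v
  ¬violation⇒gale ¬violation J L = ≮⇒≥ (λ violates → ¬violation (J , L , violates))

  module UnitStep (M : Fin b → Fin c → ℕ) (u : Fin b → ℕ) (v : Fin c → ℕ) (gale : GaleCondition M u v)
                  (j₀ : Fin b) (0<u : 0 < u j₀) where

    unit : Fin c → Fin b → Fin c → ℕ
    unit l₀ j l = when (j ≡ᵇ j₀) (δ l₀ l)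

    M⁻ : Fin c → Fin b → Fin c → ℕ
    M⁻ l₀ j l = M j l ∸ unit l₀ j l

    u⁻ : Fin b → ℕ
    u⁻ j = u j ∸ δ j₀ j

    v⁻ : Fin c → Fin c → ℕ
    v⁻ l₀ l = v l ∸ δ l₀ l

    Feasible : Fin c → Set
    Feasible l₀ = 0 < M j₀ l₀ × 0 < v l₀ × ¬ Violation (M⁻ l₀) u⁻ (v⁻ l₀)

    feasible? : ∀ l₀ → Dec (Feasible l₀)
    feasible? l₀ = (0 <? M j₀ l₀) ×-dec (0 <? v l₀) ×-dec ¬? (violation? (M⁻ l₀) u⁻ (v⁻ l₀))

    unit≤M : ∀ {l₀} → 0 < M j₀ l₀ → ∀ j l → unit l₀ j l ≤ M j l
    unit≤M 0<M j l with j F.≟ j₀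
    ... | yes refl = δ≤ _ 0<M l
    ... | no  _    = z≤n

    cut-M⁻ : ∀ {l₀} → 0 < M j₀ l₀ → ∀ J L →
      cut (M⁻ l₀) J L + when (J j₀) (when (not (L l₀)) 1) ≡ cut M J L
    cut-M⁻ {l₀} 0<M J L = begin
      cut (M⁻ l₀) J L + when (J j₀) (when (not (L l₀)) 1) ≡⟨ cong (cut (M⁻ l₀) J L +_) (sym cut-unit) ⟩
      cut (M⁻ l₀) J L + cut (unit l₀) J L                 ≡⟨ sym (cut-+ (M⁻ l₀) (unit l₀) J L) ⟩
      cut (λ j l → M⁻ l₀ j l + unit l₀ j l) J L           ≡⟨ sumOver-cong b (λ _ → refl) (λ j →
                                                               sumOver-cong c (λ _ → refl) (λ l →
                                                                 m∸n+n≡m (unit≤M 0<M j l))) ⟩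
      cut M J L                                           ∎
      where
      open ≡-Reasoning
      cut-unit : cut (unit l₀) J L ≡ when (J j₀) (when (not (L l₀)) 1)
      cut-unit = trans
        (sumOver-cong b (λ _ → refl) (λ j →
          trans (sumOver-when c (not ∘ L) (j ≡ᵇ j₀) (δ l₀))
                (cong (when (j ≡ᵇ j₀)) (sumOver-pick c (not ∘ L) l₀ (λ _ → 1)))))
        (sumOver-pick b J j₀ (λ _ → when (not (L l₀)) 1))

    violation⇒tight : ∀ {l₀ J L} → 0 < M j₀ l₀ → 0 < v l₀ → Violates (M⁻ l₀) u⁻ (v⁻ l₀) J L →
      Tight M u v J L × J j₀ ≡ false × L l₀ ≡ true
    violation⇒tight {l₀} {J} {L} 0<M 0<v violates =
      decrement-violation (J j₀) (L l₀) (sumOver-decrement b J u j₀ 0<u)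
        (sumOver-decrement c L v l₀ 0<v) (cut-M⁻ 0<M J L) violates (gale J L)

    record Blocker (l₀ : Fin c) : Set where
      field
        rows    : Fin b → Bool
        cols    : Fin c → Bool
        tight   : Tight M u v rows cols
        j₀∉rows : rows j₀ ≡ false
        blocks  : M j₀ l₀ ≡ 0 ⊎ cols l₀ ≡ true

    infeasible⇒blocker : ∀ l₀ → ¬ Feasible l₀ → Blocker l₀
    infeasible⇒blocker l₀ infeasible with M j₀ l₀ ℕ.≟ 0 | v l₀ ℕ.≟ 0 | violation? (M⁻ l₀) u⁻ (v⁻ l₀)
    ... | yes M≡0 | _       | _ = record
      { rows = λ _ → false ; cols = λ _ → false ; tight = tight-∅ M u v _ (sumOver-none c v)
      ; j₀∉rows = refl ; blocks = inj₁ M≡0 }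
    ... | no  _   | yes v≡0 | _ = record
      { rows = λ _ → false ; cols = _≡ᵇ l₀ ; tight = tight-∅ M u v _ (trans (sumFin-pick c l₀ v) v≡0)
      ; j₀∉rows = refl ; blocks = inj₂ (≡ᵇ-refl l₀) }
    ... | no  M≢0 | no  v≢0 | yes (J , L , violates) =
      let tight , j₀∉J , l₀∈L = violation⇒tight (n≢0⇒n>0 M≢0) (n≢0⇒n>0 v≢0) violates
      in record { rows = J ; cols = L ; tight = tight ; j₀∉rows = j₀∉J ; blocks = inj₂ l₀∈L }
    ... | no  M≢0 | no  v≢0 | no ¬violation =
      ⊥-elim (infeasible (n≢0⇒n>0 M≢0 , n≢0⇒n>0 v≢0 , ¬violation))

    -- The union of the blockers is a tight cut avoiding j₀ whose columns absorb all of row j₀;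
    -- adding j₀ to it then forces u j₀ = 0.
    some-feasible : ∃ Feasible
    some-feasible with any? feasible?
    ... | yes feasible = feasible
    ... | no  none     = ⊥-elim (<⇒≱ 0<u (+-cancelˡ-≤ (sumOver b J u) (u j₀) 0 j₀-adds-nothing))
      where
      blocker : ∀ l₀ → Blocker l₀
      blocker l₀ = infeasible⇒blocker l₀ (λ feasible → none (l₀ , feasible))
      open Blocker
      J : Fin b → Bool
      J = ⋃ (λ l₀ → rows (blocker l₀))
      L : Fin c → Bool
      L = ⋃ (λ l₀ → cols (blocker l₀))
      j₀∉J : J j₀ ≡ false
      j₀∉J = ⋃-⁻ _ j₀ (λ l₀ → j₀∉rows (blocker l₀))
      row-j₀-absorbed : ∀ l → when (not (L l)) (M j₀ l) ≡ 0
      row-j₀-absorbed l with blocks (blocker l)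
      ... | inj₁ M≡0 = trans (cong (when (not (L l))) M≡0) (when-zero _)
      ... | inj₂ l∈L = cong (λ l∈? → when (not l∈?) (M j₀ l)) (⋃-⁺ _ l l l∈L)
      j₀-adds-nothing : sumOver b J u + u j₀ ≤ sumOver b J u + 0
      j₀-adds-nothing = begin
        sumOver b J u + u j₀                                 ≡⟨ sym (sumOver-insert b J j₀ j₀∉J u) ⟩
        sumOver b (λ j → J j ∨ (j ≡ᵇ j₀)) u                  ≤⟨ gale _ L ⟩
        cut M (λ j → J j ∨ (j ≡ᵇ j₀)) L + sumOver c L v      ≡⟨ cong (_+ sumOver c L v) (sumOver-insert b J j₀ j₀∉J _) ⟩
        cut M J L + sumOver c (not ∘ L) (M j₀) + sumOver c L v
          ≡⟨ cong (λ x → cut M J L + x + sumOver c L v) (trans (sumFin-cong c row-j₀-absorbed) (sumFin-zero c)) ⟩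
        cut M J L + 0 + sumOver c L v                        ≡⟨ cong (_+ sumOver c L v) (+-identityʳ _) ⟩
        cut M J L + sumOver c L v                            ≡⟨ sym (tight-⋃ M u v gale _ _ (λ l₀ → tight (blocker l₀))) ⟩
        sumOver b J u                                        ≡⟨ sym (+-identityʳ _) ⟩
        sumOver b J u + 0                                    ∎
        where open ≤-Reasoning

    restore : ∀ {l₀} → 0 < M j₀ l₀ → 0 < v l₀ → Transport (M⁻ l₀) u⁻ (v⁻ l₀) → Transport M u v
    restore {l₀} 0<M 0<v (X , X≤M⁻ , rows , cols) = X⁺ , X⁺≤M , rows⁺ , cols⁺
      where
      X⁺ : Fin b → Fin c → ℕ
      X⁺ j l = X j l + unit l₀ j l
      X⁺≤M : ∀ j l → X⁺ j l ≤ M j l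
      X⁺≤M j l = ≤-trans (+-monoˡ-≤ (unit l₀ j l) (X≤M⁻ j l)) (≤-reflexive (m∸n+n≡m (unit≤M 0<M j l)))
      rows⁺ : ∀ j → sumFin c (X⁺ j) ≡ u j
      rows⁺ j = begin
        sumFin c (X⁺ j)                        ≡⟨ sumFin-+ c _ _ ⟩
        sumFin c (X j) + sumFin c (unit l₀ j)  ≡⟨ cong₂ _+_ (rows j) (trans (sumFin-when c (j ≡ᵇ j₀) (δ l₀))
                                                                      (cong (when (j ≡ᵇ j₀)) (sumFin-δ c l₀))) ⟩
        u⁻ j + δ j₀ j                          ≡⟨ m∸n+n≡m (δ≤ j₀ 0<u j) ⟩
        u j                                    ∎
        where open ≡-Reasoning
      cols⁺ : ∀ l → sumFin b (λ j → X⁺ j l) ≡ v l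
      cols⁺ l = begin
        sumFin b (λ j → X⁺ j l)                                ≡⟨ sumFin-+ b _ _ ⟩
        sumFin b (λ j → X j l) + sumFin b (λ j → unit l₀ j l)  ≡⟨ cong₂ _+_ (cols l) (sumFin-pick b j₀ (λ _ → δ l₀ l)) ⟩
        v⁻ l₀ l + δ l₀ l                                       ≡⟨ m∸n+n≡m (δ≤ l₀ 0<v l) ⟩
        v l                                                    ∎
        where open ≡-Reasoning

    reduce : ∀ N → sumFin b u ≡ suc N → sumFin c v ≡ suc N →
      (∀ M′ u′ v′ → sumFin b u′ ≡ N → sumFin c v′ ≡ N → GaleCondition M′ u′ v′ → Transport M′ u′ v′) →
      Transport M u v
    reduce N Σu Σv transport-smaller =
      let l₀ , 0<M , 0<v , ¬violation = some-feasible
      in restore 0<M 0<v (transport-smaller (M⁻ l₀) u⁻ (v⁻ l₀)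
           (sumFin-decrement b u j₀ 0<u Σu) (sumFin-decrement c v l₀ 0<v Σv) (¬violation⇒gale ¬violation))

  transportation : ∀ N M u v → sumFin b u ≡ N → sumFin c v ≡ N → GaleCondition M u v → Transport M u v
  transportation zero M u v Σu≡0 Σv≡0 _ =
    (λ _ _ → 0) , (λ _ _ → z≤n) ,
    (λ j → trans (sumFin-zero c) (sym (sumFin≡0⇒≡0 b u Σu≡0 j))) ,
    (λ l → trans (sumFin-zero b) (sym (sumFin≡0⇒≡0 c v Σv≡0 l)))
  transportation (suc N) M u v Σu Σv gale =
    let j₀ , 0<u = sumFin>0⇒>0 b u (subst (0 <_) (sym Σu) (s≤s z≤n))
    in UnitStep.reduce M u v gale j₀ 0<u N Σu Σv (transportation N)

sumℕ : ℕ → (ℕ → ℕ) → ℕ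
sumℕ zero    G = 0
sumℕ (suc p) G = G 0 + sumℕ p (G ∘ suc)

module Decomposition {b c : ℕ} where
  open Transportation b c

  totals-agree : ∀ p (M : Fin b → Fin c → ℕ) u v →
    (∀ j → sumFin c (M j) ≡ suc p * u j) → (∀ l → sumFin b (λ j → M j l) ≡ suc p * v l) →
    sumFin c v ≡ sumFin b u
  totals-agree p M u v rows cols = *-cancelˡ-≡ _ _ (suc p) (begin
    suc p * sumFin c v                      ≡⟨ sym (sumFin-*ˡ c (suc p) v) ⟩
    sumFin c (λ l → suc p * v l)            ≡⟨ sumFin-cong c (λ l → sym (cols l)) ⟩
    sumFin c (λ l → sumFin b (λ j → M j l)) ≡⟨ sumFin-comm c b (λ l j → M j l) ⟩
    sumFin b (λ j → sumFin c (M j))         ≡⟨ sumFin-cong b rows ⟩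
    sumFin b (λ j → suc p * u j)            ≡⟨ sumFin-*ˡ b (suc p) u ⟩
    suc p * sumFin b u                      ∎)
    where open ≡-Reasoning

  -- M / (1 + p) is a fractional transport plan, so every cut has enough capacity.
  gale-of-multiple : ∀ p (M : Fin b → Fin c → ℕ) u v →
    (∀ j → sumFin c (M j) ≡ suc p * u j) → (∀ l → sumFin b (λ j → M j l) ≡ suc p * v l) → GaleCondition M u v
  gale-of-multiple p M u v rows cols J L = *-cancelˡ-≤ (suc p) (begin
    suc p * sumOver b J u                                        ≡⟨ sym (sumOver-*ˡ b J (suc p) u) ⟩
    sumOver b J (λ j → suc p * u j)                              ≡⟨ sumOver-cong b (λ _ → refl) (λ j →
                                                                      trans (sym (rows j)) (sym (sumOver-compl c L (M j)))) ⟩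
    sumOver b J (λ j → sumOver c (not ∘ L) (M j) + sumOver c L (M j)) ≡⟨ sumOver-+ b J _ _ ⟩
    cut M J L + sumOver b J (λ j → sumOver c L (M j))            ≤⟨ +-monoʳ-≤ (cut M J L) (sumOver≤sumFin b J _) ⟩
    cut M J L + sumFin b (λ j → sumOver c L (M j))               ≡⟨ cong (cut M J L +_) columns-in-L ⟩
    cut M J L + suc p * sumOver c L v                            ≤⟨ +-monoˡ-≤ _ (m≤n*m (cut M J L) (suc p)) ⟩
    suc p * cut M J L + suc p * sumOver c L v                    ≡⟨ sym (*-distribˡ-+ (suc p) (cut M J L) _) ⟩
    suc p * (cut M J L + sumOver c L v)                          ∎)
    where
    open ≤-Reasoning
    columns-in-L : sumFin b (λ j → sumOver c L (M j)) ≡ suc p * sumOver c L v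
    columns-in-L = begin-equality
      sumFin b (λ j → sumOver c L (M j))                       ≡⟨ sumFin-comm b c (λ j l → when (L l) (M j l)) ⟩
      sumFin c (λ l → sumFin b (λ j → when (L l) (M j l)))     ≡⟨ sumFin-cong c (λ l →
                                                                     trans (sumFin-when b (L l) (λ j → M j l))
                                                                           (cong (when (L l)) (cols l))) ⟩
      sumOver c L (λ l → suc p * v l)                          ≡⟨ sumOver-*ˡ c L (suc p) v ⟩
      suc p * sumOver c L v                                    ∎

  record Layers (p : ℕ) (M : Fin b → Fin c → ℕ) (u : Fin b → ℕ) (v : Fin c → ℕ) : Set where
    field
      layer   : ℕ → Fin b → Fin c → ℕ
      margins : ∀ t → t < p → (∀ j → sumFin c (layer t j) ≡ u j) × (∀ l → sumFin b (λ j → layer t j l) ≡ v l)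
      total   : ∀ j l → sumℕ p (λ t → layer t j l) ≡ M j l

  decompose : ∀ p (M : Fin b → Fin c → ℕ) u v →
    (∀ j → sumFin c (M j) ≡ p * u j) → (∀ l → sumFin b (λ j → M j l) ≡ p * v l) → Layers p M u v
  decompose zero M u v rows cols = record
    { layer = λ _ _ _ → 0 ; margins = λ _ () ; total = λ j l → sym (sumFin≡0⇒≡0 c (M j) (rows j) l) }
  decompose (suc p) M u v rows cols
    with transportation (sumFin b u) M u v refl (totals-agree p M u v rows cols) (gale-of-multiple p M u v rows cols)
  ... | layer₀ , layer₀≤M , rows₀ , cols₀ = record { layer = D ; margins = margins ; total = total }
    where
    rest : Fin b → Fin c → ℕ
    rest j l = M j l ∸ layer₀ j l
    rows-rest : ∀ j → sumFin c (rest j) ≡ p * u j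
    rows-rest j = +-cancelʳ-≡ (u j) _ _ (begin
      sumFin c (rest j) + u j            ≡⟨ cong (sumFin c (rest j) +_) (sym (rows₀ j)) ⟩
      sumFin c (rest j) + sumFin c (layer₀ j) ≡⟨ sumFin-∸ c (M j) (layer₀ j) (layer₀≤M j) ⟩
      sumFin c (M j)                     ≡⟨ trans (rows j) (+-comm (u j) _) ⟩
      p * u j + u j                      ∎)
      where open ≡-Reasoning
    cols-rest : ∀ l → sumFin b (λ j → rest j l) ≡ p * v l
    cols-rest l = +-cancelʳ-≡ (v l) _ _ (begin
      sumFin b (λ j → rest j l) + v l    ≡⟨ cong (sumFin b (λ j → rest j l) +_) (sym (cols₀ l)) ⟩
      sumFin b (λ j → rest j l) + sumFin b (λ j → layer₀ j l)
                                         ≡⟨ sumFin-∸ b (λ j → M j l) (λ j → layer₀ j l) (λ j → layer₀≤M j l) ⟩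
      sumFin b (λ j → M j l)             ≡⟨ trans (cols l) (+-comm (v l) _) ⟩
      p * v l + v l                      ∎)
      where open ≡-Reasoning
    module Rest = Layers (decompose p rest u v rows-rest cols-rest)
    D : ℕ → Fin b → Fin c → ℕ
    D zero    = layer₀
    D (suc t) = Rest.layer t
    margins : ∀ t → t < suc p → (∀ j → sumFin c (D t j) ≡ u j) × (∀ l → sumFin b (λ j → D t j l) ≡ v l)
    margins zero    _       = rows₀ , cols₀
    margins (suc t) 1+t<1+p = Rest.margins t (s≤s⁻¹ 1+t<1+p)
    total : ∀ j l → sumℕ (suc p) (λ t → D t j l) ≡ M j l
    total j l = trans (cong (layer₀ j l +_) (Rest.total j l)) (m+[n∸m]≡n (layer₀≤M j l))

-- Consecutive blocks

inInterval : ℕ → ℕ → ℕ → Bool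
inInterval a m x = (a ≤ᵇ x) ∧ (x <ᵇ a + m)

inInterval⇒ : ∀ a m x → inInterval a m x ≡ true → a ≤ x × x < a + m
inInterval⇒ a m x x∈ = let a≤ᵇx , x<ᵇa+m = to T-∧ (from T-≡ x∈) in ≤ᵇ⇒≤ a x a≤ᵇx , <ᵇ⇒< x (a + m) x<ᵇa+m

⇒inInterval : ∀ a m x → a ≤ x → x < a + m → inInterval a m x ≡ true
⇒inInterval a m x a≤x x<a+m = to T-≡ (from T-∧ (≤⇒≤ᵇ a≤x , <⇒<ᵇ x<a+m))

∉inInterval : ∀ a m x → ¬ (a ≤ x × x < a + m) → inInterval a m x ≡ false
∉inInterval a m x x∉ with inInterval a m x in x∈?
... | true  = ⊥-elim (x∉ (inInterval⇒ a m x x∈?))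
... | false = refl

offset-zero : ∀ k (h : Fin (suc k) → ℕ) → offset (suc k) h zero ≡ 0
offset-zero k h = sumFin-zero k

offset-< : ∀ k (h : Fin k → ℕ) (i j : Fin k) → toℕ i < toℕ j → offset k h i + h i ≤ offset k h j
offset-< (suc k) h zero    (suc j) _ rewrite offset-zero k h = m≤m+n (h zero) _
offset-< (suc k) h (suc i) (suc j) i<j =
  ≤-trans (≤-reflexive (+-assoc (h zero) (offset k (h ∘ suc) i) (h (suc i))))
          (+-monoʳ-≤ (h zero) (offset-< k (h ∘ suc) i j (s≤s⁻¹ i<j)))

offset+size≤total : ∀ k (h : Fin k → ℕ) i → offset k h i + h i ≤ sumFin k h
offset+size≤total (suc k) h zero rewrite offset-zero k h = m≤m+n (h zero) _
offset+size≤total (suc k) h (suc i) =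
  ≤-trans (≤-reflexive (+-assoc (h zero) (offset k (h ∘ suc) i) (h (suc i))))
          (+-monoʳ-≤ (h zero) (offset+size≤total k (h ∘ suc) i))

block-unique : ∀ k (h : Fin k → ℕ) (i j : Fin k) x →
  inInterval (offset k h i) (h i) x ≡ true → inInterval (offset k h j) (h j) x ≡ true → i ≡ j
block-unique k h i j x x∈i x∈j with inInterval⇒ _ _ x x∈i | inInterval⇒ _ _ x x∈j | <-cmp (toℕ i) (toℕ j)
... | _       , x<end-i | start-j≤x , _ | tri< i<j _ _ = ⊥-elim (<⇒≱ (<-≤-trans x<end-i (offset-< k h i j i<j)) start-j≤x)
... | _       , _       | _ , _         | tri≈ _ i≡j _ = toℕ-injective i≡j
... | start-i≤x , _     | _ , x<end-j   | tri> _ _ j<i = ⊥-elim (<⇒≱ (<-≤-trans x<end-j (offset-< k h j i j<i)) start-i≤x)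

block-exists : ∀ k (h : Fin k → ℕ) x → x < sumFin k h → Σ (Fin k) λ i → inInterval (offset k h i) (h i) x ≡ true
block-exists (suc k) h x x<total with x <? h zero
... | yes x<h₀ = zero , subst (λ o → inInterval o (h zero) x ≡ true) (sym (offset-zero k h)) (⇒inInterval 0 (h zero) x z≤n x<h₀)
... | no  x≮h₀ with block-exists k (h ∘ suc) (x ∸ h zero) x-h₀<rest
  where
  x-h₀<rest : x ∸ h zero < sumFin k (h ∘ suc)
  x-h₀<rest = +-cancelˡ-< (h zero) _ _ (subst (_< h zero + sumFin k (h ∘ suc)) (sym (m+[n∸m]≡n (≮⇒≥ x≮h₀))) x<total)
...   | i , x-h₀∈i with inInterval⇒ _ _ _ x-h₀∈i
...     | start≤ , <end = suc i , ⇒inInterval _ _ x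
      (subst (h zero + offset k (h ∘ suc) i ≤_) (m+[n∸m]≡n (≮⇒≥ x≮h₀)) (+-monoʳ-≤ (h zero) start≤))
      (subst₂ _<_ (m+[n∸m]≡n (≮⇒≥ x≮h₀)) (sym (+-assoc (h zero) _ _)) (+-monoʳ-< (h zero) <end))

sumFin-toℕ : ∀ N (G : ℕ → ℕ) → sumFin N (λ r → G (toℕ r)) ≡ sumℕ N G
sumFin-toℕ zero    G = refl
sumFin-toℕ (suc N) G = cong (G 0 +_) (sumFin-toℕ N (G ∘ suc))

sumℕ-cong : ∀ n {F G : ℕ → ℕ} → (∀ x → x < n → F x ≡ G x) → sumℕ n F ≡ sumℕ n G
sumℕ-cong zero    F≗G = refl
sumℕ-cong (suc n) F≗G = cong₂ _+_ (F≗G 0 (s≤s z≤n)) (sumℕ-cong n (λ x x<n → F≗G (suc x) (s≤s x<n)))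

sumℕ-zero : ∀ n → sumℕ n (λ _ → 0) ≡ 0
sumℕ-zero zero    = refl
sumℕ-zero (suc n) = sumℕ-zero n

sumℕ-+ : ∀ p q (G : ℕ → ℕ) → sumℕ (p + q) G ≡ sumℕ p G + sumℕ q (λ t → G (p + t))
sumℕ-+ zero    q G = refl
sumℕ-+ (suc p) q G = trans (cong (G 0 +_) (sumℕ-+ p q (G ∘ suc))) (sym (+-assoc (G 0) _ _))

sumℕ-interval : ∀ a m r (g : ℕ → ℕ) →
  sumℕ (a + m + r) (λ x → when (inInterval a m x) (g x)) ≡ sumℕ m (λ t → g (a + t))
sumℕ-interval a m r g = begin
  sumℕ (a + m + r) F                                    ≡⟨ sumℕ-+ (a + m) r F ⟩
  sumℕ (a + m) F + sumℕ r (λ t → F (a + m + t))         ≡⟨ cong₂ _+_ (sumℕ-+ a m F) (trans (sumℕ-cong r after) (sumℕ-zero r)) ⟩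
  sumℕ a F + sumℕ m (λ t → F (a + t)) + 0               ≡⟨ cong (λ s → s + sumℕ m (λ t → F (a + t)) + 0)
                                                             (trans (sumℕ-cong a before) (sumℕ-zero a)) ⟩
  sumℕ m (λ t → F (a + t)) + 0                          ≡⟨ +-identityʳ _ ⟩
  sumℕ m (λ t → F (a + t))                              ≡⟨ sumℕ-cong m inside ⟩
  sumℕ m (λ t → g (a + t))                              ∎
  where
  open ≡-Reasoning
  F : ℕ → ℕ
  F x = when (inInterval a m x) (g x)
  before : ∀ x → x < a → F x ≡ 0
  before x x<a rewrite ∉inInterval a m x (λ (a≤x , _) → <⇒≱ x<a a≤x) = refl
  inside : ∀ t → t < m → F (a + t) ≡ g (a + t)
  inside t t<m rewrite ⇒inInterval a m (a + t) (m≤m+n a t) (+-monoʳ-< a t<m) = refl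
  after : ∀ t → t < r → F (a + m + t) ≡ 0
  after t _ rewrite ∉inInterval a m (a + m + t) (λ (_ , <a+m) → <⇒≱ <a+m (m≤m+n (a + m) t)) = refl

sumFin-inBlock : ∀ k (h : Fin k → ℕ) i (g : ℕ → ℕ) →
  sumFin (sumFin k h) (λ r → when (inBlock k h i r) (g (toℕ r))) ≡ sumℕ (h i) (λ t → g (offset k h i + t))
sumFin-inBlock k h i g = begin
  sumFin (sumFin k h) (λ r → when (inBlock k h i r) (g (toℕ r)))  ≡⟨ sumFin-toℕ (sumFin k h) G ⟩
  sumℕ (sumFin k h) G                                              ≡⟨ cong (λ N → sumℕ N G) (sym (m+[n∸m]≡n (offset+size≤total k h i))) ⟩
  sumℕ (offset k h i + h i + (sumFin k h ∸ (offset k h i + h i))) G ≡⟨ sumℕ-interval (offset k h i) (h i) _ g ⟩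
  sumℕ (h i) (λ t → g (offset k h i + t))                           ∎
  where
  open ≡-Reasoning
  G : ℕ → ℕ
  G x = when (inInterval (offset k h i) (h i) x) (g x)

module BlockStructure (k : ℕ) (h : Fin k → ℕ) where

  n : ℕ
  n = sumFin k h

  abstract
    blockOf : Fin n → Fin k
    blockOf r = proj₁ (block-exists k h (toℕ r) (toℕ<n r))

    inBlock-blockOf : ∀ r → inBlock k h (blockOf r) r ≡ true
    inBlock-blockOf r = proj₂ (block-exists k h (toℕ r) (toℕ<n r))

  blockOf-unique : ∀ i r → inBlock k h i r ≡ true → blockOf r ≡ i
  blockOf-unique i r r∈i = block-unique k h (blockOf r) i (toℕ r) (inBlock-blockOf r) r∈i

  inBlock≡ᵇblockOf : ∀ i r → inBlock k h i r ≡ (i ≡ᵇ blockOf r)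
  inBlock≡ᵇblockOf i r with i F.≟ blockOf r
  ... | yes refl = inBlock-blockOf r
  ... | no  i≢ with inBlock k h i r in r∈i?
  ...   | true  = ⊥-elim (i≢ (sym (blockOf-unique i r r∈i?)))
  ...   | false = refl

  sumFin-byBlocks : ∀ (g : Fin n → ℕ) → sumFin n g ≡ sumFin k (λ i → sumFin n (λ r → when (inBlock k h i r) (g r)))
  sumFin-byBlocks g = sym (begin
    sumFin k (λ i → sumFin n (λ r → when (inBlock k h i r) (g r))) ≡⟨ sumFin-comm k n _ ⟩
    sumFin n (λ r → sumFin k (λ i → when (inBlock k h i r) (g r))) ≡⟨ sumFin-cong n (λ r →
                                                                        sumFin-cong k (λ i → cong (λ b → when b (g r)) (inBlock≡ᵇblockOf i r))) ⟩
    sumFin n (λ r → sumFin k (λ i → when (i ≡ᵇ blockOf r) (g r)))  ≡⟨ sumFin-cong n (λ r → sumFin-pick k (blockOf r) (λ _ → g r)) ⟩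
    sumFin n g                                                     ∎)
    where open ≡-Reasoning

  offset≤ : ∀ i (r : Fin n) → inBlock k h i r ≡ true → offset k h i ≤ toℕ r
  offset≤ i r r∈i = proj₁ (inInterval⇒ (offset k h i) (h i) (toℕ r) r∈i)

  position< : ∀ i (r : Fin n) → inBlock k h i r ≡ true → toℕ r ∸ offset k h i < h i
  position< i r r∈i = +-cancelˡ-< (offset k h i) _ _
    (subst (_< offset k h i + h i) (sym (m+[n∸m]≡n (offset≤ i r r∈i))) (proj₂ (inInterval⇒ (offset k h i) (h i) (toℕ r) r∈i)))

  member< : ∀ i (t : Fin (h i)) → offset k h i + toℕ t < n
  member< i t = <-≤-trans (+-monoʳ-< (offset k h i) (toℕ<n t)) (offset+size≤total k h i)

  abstract
    member : (i : Fin k) → Fin (h i) → Fin n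
    member i t = fromℕ< (member< i t)

    toℕ-member : ∀ i t → toℕ (member i t) ≡ offset k h i + toℕ t
    toℕ-member i t = toℕ-fromℕ< (member< i t)

    index : ∀ i (r : Fin n) → inBlock k h i r ≡ true → Fin (h i)
    index i r r∈i = fromℕ< (position< i r r∈i)

    member-index : ∀ i r r∈i → member i (index i r r∈i) ≡ r
    member-index i r r∈i = toℕ-injective (begin
      toℕ (member i (index i r r∈i))                        ≡⟨ toℕ-member i _ ⟩
      offset k h i + toℕ (fromℕ< (position< i r r∈i))       ≡⟨ cong (offset k h i +_) (toℕ-fromℕ< (position< i r r∈i)) ⟩
      offset k h i + (toℕ r ∸ offset k h i)                 ≡⟨ m+[n∸m]≡n (offset≤ i r r∈i) ⟩
      toℕ r                                                 ∎)
      where open ≡-Reasoning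

  member-injective : ∀ i {t t′} → member i t ≡ member i t′ → t ≡ t′
  member-injective i {t} {t′} eq = toℕ-injective (+-cancelˡ-≡ (offset k h i) _ _
    (trans (sym (toℕ-member i t)) (trans (cong toℕ eq) (toℕ-member i t′))))

  inBlock-member : ∀ i t → inBlock k h i (member i t) ≡ true
  inBlock-member i t = subst (λ x → inInterval (offset k h i) (h i) x ≡ true) (sym (toℕ-member i t))
    (⇒inInterval _ _ _ (m≤m+n (offset k h i) (toℕ t)) (+-monoʳ-< (offset k h i) (toℕ<n t)))

-- Outlines and their lifting

IsOutlineFor : ∀ {a b c} → (Fin a → ℕ) → (Fin b → ℕ) → (Fin c → ℕ) → (Fin a → Fin b → Fin c → ℕ) → Set
IsOutlineFor {a} {b} {c} p q r T =
  (∀ i j → sumFin c (T i j) ≡ p i * q j) ×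
  (∀ i l → sumFin b (λ j → T i j l) ≡ p i * r l) ×
  (∀ j l → sumFin a (λ i → T i j l) ≡ q j * r l)

IsOutlineFor-rotate : ∀ {a b c p q r} {T : Fin a → Fin b → Fin c → ℕ} →
  IsOutlineFor p q r T → IsOutlineFor q r p (λ j l i → T i j l)
IsOutlineFor-rotate {p = p} {q} {r} (cells , rows , cols) =
  cols , (λ j i → trans (cells i j) (*-comm (p i) (q j))) , (λ l i → trans (rows i l) (*-comm (p i) (r l)))

Amalgamates : ∀ k (h : Fin k → ℕ) {b c} → (Fin (sumFin k h) → Fin b → Fin c → ℕ) → (Fin k → Fin b → Fin c → ℕ) → Set
Amalgamates k h T′ T = ∀ i j l → sumFin (sumFin k h) (λ r → when (inBlock k h i r) (T′ r j l)) ≡ T i j l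

record Refinement k (h : Fin k → ℕ) {b c} (q : Fin b → ℕ) (r : Fin c → ℕ) (T : Fin k → Fin b → Fin c → ℕ) : Set where
  field
    refined     : Fin (sumFin k h) → Fin b → Fin c → ℕ
    isOutline   : IsOutlineFor (λ _ → 1) q r refined
    amalgamates : Amalgamates k h refined T

-- Row block i of T has margins h i · q and h i · r, so decompose splits it into h i rows of a
-- (1, q, r)-outline.
refine : ∀ k (h : Fin k → ℕ) {b c} (q : Fin b → ℕ) (r : Fin c → ℕ) (T : Fin k → Fin b → Fin c → ℕ) →
  IsOutlineFor h q r T → Refinement k h q r T
refine k h {b} {c} q r T (cells , rows , cols) = record
  { refined = T′ ; isOutline = cells′ , rows′ , cols′ ; amalgamates = amalgamates }
  where
  open BlockStructure k h
  open Decomposition {b} {c}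
  layers : ∀ i → Layers (h i) (T i) q r
  layers i = decompose (h i) (T i) q r (cells i) (rows i)
  layer : Fin k → ℕ → Fin b → Fin c → ℕ
  layer i = Layers.layer (layers i)
  T′ : Fin n → Fin b → Fin c → ℕ
  T′ x = layer (blockOf x) (toℕ x ∸ offset k h (blockOf x))
  margins : ∀ x → (∀ j → sumFin c (T′ x j) ≡ q j) × (∀ l → sumFin b (λ j → T′ x j l) ≡ r l)
  margins x = Layers.margins (layers (blockOf x)) _ (position< (blockOf x) x (inBlock-blockOf x))
  cells′ : ∀ x j → sumFin c (T′ x j) ≡ 1 * q j
  cells′ x j = trans (proj₁ (margins x) j) (sym (*-identityˡ _))
  rows′ : ∀ x l → sumFin b (λ j → T′ x j l) ≡ 1 * r l
  rows′ x l = trans (proj₂ (margins x) l) (sym (*-identityˡ _))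
  amalgamates : Amalgamates k h T′ T
  amalgamates i j l = begin
    sumFin n (λ x → when (inBlock k h i x) (T′ x j l))
      ≡⟨ sumFin-cong n (λ x → when-cong (inBlock k h i x) (λ x∈i →
           cong (λ i′ → layer i′ (toℕ x ∸ offset k h i′) j l) (blockOf-unique i x x∈i))) ⟩
    sumFin n (λ x → when (inBlock k h i x) (layer i (toℕ x ∸ offset k h i) j l))
      ≡⟨ sumFin-inBlock k h i (λ y → layer i (y ∸ offset k h i) j l) ⟩
    sumℕ (h i) (λ t → layer i (offset k h i + t ∸ offset k h i) j l)
      ≡⟨ sumℕ-cong (h i) (λ t _ → cong (λ t′ → layer i t′ j l) (m+n∸m≡n (offset k h i) t)) ⟩
    sumℕ (h i) (λ t → layer i t j l)
      ≡⟨ Layers.total (layers i) j l ⟩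
    T i j l ∎
    where open ≡-Reasoning
  cols′ : ∀ j l → sumFin n (λ x → T′ x j l) ≡ q j * r l
  cols′ j l = trans (sumFin-byBlocks (λ x → T′ x j l)) (trans (sumFin-cong k (λ i → amalgamates i j l)) (cols j l))

module UnitOutline {n} (T : Fin n → Fin n → Fin n → ℕ)
                   (unit : IsOutlineFor (λ _ → 1) (λ _ → 1) (λ _ → 1) T) where

  abstract
    L : Fin n → Fin n → Fin n
    L r c = proj₁ (sumFin≡1⇒δ n (T r c) (proj₁ unit r c))

    T≡δ : ∀ r c s → T r c s ≡ δ (L r c) s
    T≡δ r c = proj₂ (sumFin≡1⇒δ n (T r c) (proj₁ unit r c))

  L≡⇒T≡1 : ∀ {r c s} → L r c ≡ s → T r c s ≡ 1
  L≡⇒T≡1 {r} {c} refl = trans (T≡δ r c (L r c)) (δ-self (L r c))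

  T≡1⇒L≡ : ∀ {r c s} → T r c s ≡ 1 → L r c ≡ s
  T≡1⇒L≡ {r} {c} {s} Trcs≡1 = sym (δ≡1⇒≡ (trans (sym (T≡δ r c s)) Trcs≡1))

  latin : IsLatin n L
  latin = rows , cols
    where
    rows : ∀ r s → Σ (Fin n) λ c → L r c ≡ s × (∀ c′ → L r c′ ≡ s → c′ ≡ c)
    rows r s = let c , Trcs≡1 , unique = sumFin≡1⇒∃! n (λ c → T r c s) (proj₁ (proj₂ unit) r s)
               in c , T≡1⇒L≡ Trcs≡1 , λ c′ Lrc′≡s → unique c′ (L≡⇒T≡1 Lrc′≡s)
    cols : ∀ c s → Σ (Fin n) λ r → L r c ≡ s × (∀ r′ → L r′ c ≡ s → r′ ≡ r)
    cols c s = let r , Trcs≡1 , unique = sumFin≡1⇒∃! n (λ r → T r c s) (proj₂ (proj₂ unit) c s)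
               in r , T≡1⇒L≡ Trcs≡1 , λ r′ Lr′c≡s → unique r′ (L≡⇒T≡1 Lr′c≡s)

  sumFin-symbols : ∀ (g : Fin n → Bool) r c → sumFin n (λ s → when (g s) (T r c s)) ≡ when (g (L r c)) 1
  sumFin-symbols g r c = trans
    (sumFin-cong n (λ s → trans (cong (when (g s)) (T≡δ r c s)) (when-comm (g s) _ 1)))
    (sumFin-pick n (L r c) (λ s → when (g s) 1))

outline-lifts : ∀ k (h : Fin k → ℕ) (C : MultisetArray k) → IsOutline k h C →
  Σ (Fin (sumFin k h) → Fin (sumFin k h) → Fin (sumFin k h)) λ L →
    IsLatin (sumFin k h) L × LiftsTo (sumFin k h) k h C L
outline-lifts k h C outline = L , latin , lifts
  where
  n = sumFin k h
  open Refinement (refine k h h h C outline)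
    renaming (refined to T₁; isOutline to outline₁; amalgamates to amalgamates₁)
  open Refinement (refine k h h (λ _ → 1) (λ j l r → T₁ r j l) (IsOutlineFor-rotate {p = λ _ → 1} {h} {h} outline₁))
    renaming (refined to T₂; isOutline to outline₂; amalgamates to amalgamates₂)
  open Refinement (refine k h (λ _ → 1) (λ _ → 1) (λ l r c → T₂ c l r) (IsOutlineFor-rotate {p = λ _ → 1} {h} {λ _ → 1} outline₂))
    renaming (refined to T₃; isOutline to outline₃; amalgamates to amalgamates₃)
  open UnitOutline (λ r c s → T₃ s r c) (IsOutlineFor-rotate {p = λ _ → 1} {λ _ → 1} {λ _ → 1} outline₃)
  lifts : LiftsTo n k h C L
  lifts i j l = begin
    reduction n k h L i j l
      ≡⟨ sumFin-cong n (λ r → trans (sumFin-cong n (λ c → when-∧∧ (r ∈ᵇ i) (c ∈ᵇ j) (L r c ∈ᵇ l)))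
                                    (sumFin-when n (r ∈ᵇ i) _)) ⟩
    sumFin n (λ r → when (r ∈ᵇ i) (sumFin n (λ c → when (c ∈ᵇ j) (when (L r c ∈ᵇ l) 1))))
      ≡⟨ sumFin-cong n (λ r → cong (when (r ∈ᵇ i)) (sumFin-cong n (λ c → cong (when (c ∈ᵇ j))
           (sym (sumFin-symbols (_∈ᵇ l) r c))))) ⟩
    sumFin n (λ r → when (r ∈ᵇ i) (sumFin n (λ c → when (c ∈ᵇ j) (sumFin n (λ s → when (s ∈ᵇ l) (T₃ s r c))))))
      ≡⟨ sumFin-cong n (λ r → cong (when (r ∈ᵇ i)) (sumFin-cong n (λ c → cong (when (c ∈ᵇ j)) (amalgamates₃ l r c)))) ⟩
    sumFin n (λ r → when (r ∈ᵇ i) (sumFin n (λ c → when (c ∈ᵇ j) (T₂ c l r))))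
      ≡⟨ sumFin-cong n (λ r → cong (when (r ∈ᵇ i)) (amalgamates₂ j l r)) ⟩
    sumFin n (λ r → when (r ∈ᵇ i) (T₁ r j l))
      ≡⟨ amalgamates₁ i j l ⟩
    C i j l ∎
    where
    open ≡-Reasoning
    _∈ᵇ_ : Fin n → Fin k → Bool
    x ∈ᵇ i = inBlock k h i x
    when-∧∧ : ∀ a b c → when (a ∧ b ∧ c) 1 ≡ when a (when b (when c 1))
    when-∧∧ true  true  c = refl
    when-∧∧ true  false c = refl
    when-∧∧ false b     c = refl

-- Floors and fractional parts

ℕtoℚ≡mkℚ : ∀ m → ℕtoℚ m ≡ mkℚ (ℤ.+ m) 0 (Coprimality.sym (Coprimality.1-coprimeTo m))
ℕtoℚ≡mkℚ m = ℚP.normalize-coprime (Coprimality.sym (Coprimality.1-coprimeTo m))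

ℕtoℚ-+ : ∀ a b → ℕtoℚ (a + b) ≡ ℕtoℚ a ℚ.+ ℕtoℚ b
ℕtoℚ-+ a b rewrite ℕtoℚ≡mkℚ a | ℕtoℚ≡mkℚ b =
  cong (ℚ._/ 1) (trans (ℤP.pos-+ a b) (sym (cong₂ ℤ._+_ (ℤP.*-identityʳ (ℤ.+ a)) (ℤP.*-identityʳ (ℤ.+ b)))))

ℕtoℚ-injective : ∀ a b → ℕtoℚ a ≡ ℕtoℚ b → a ≡ b
ℕtoℚ-injective a b eq = ℤP.+-injective (cong ↥_ (trans (sym (ℕtoℚ≡mkℚ a)) (trans eq (ℕtoℚ≡mkℚ b))))

sumFinℚ≗sum : ∀ n (f : Fin n → ℚ) → sumFinℚ n f ≡ ℚ∑.sum f
sumFinℚ≗sum zero    f = refl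
sumFinℚ≗sum (suc n) f = cong (f zero ℚ.+_) (sumFinℚ≗sum n (f ∘ suc))

sumFinℚ-cong : ∀ n {f g : Fin n → ℚ} → (∀ i → f i ≡ g i) → sumFinℚ n f ≡ sumFinℚ n g
sumFinℚ-cong zero    f≗g = refl
sumFinℚ-cong (suc n) f≗g = cong₂ ℚ._+_ (f≗g zero) (sumFinℚ-cong n (f≗g ∘ suc))

sumFinℚ-+ : ∀ n (f g : Fin n → ℚ) → sumFinℚ n (λ i → f i ℚ.+ g i) ≡ sumFinℚ n f ℚ.+ sumFinℚ n g
sumFinℚ-+ n f g = begin
  sumFinℚ n (λ i → f i ℚ.+ g i) ≡⟨ sumFinℚ≗sum n _ ⟩
  ℚ∑.sum (λ i → f i ℚ.+ g i)   ≡⟨ ℚ∑.∑-distrib-+ f g ⟩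
  ℚ∑.sum f ℚ.+ ℚ∑.sum g         ≡⟨ sym (cong₂ ℚ._+_ (sumFinℚ≗sum n f) (sumFinℚ≗sum n g)) ⟩
  sumFinℚ n f ℚ.+ sumFinℚ n g   ∎
  where open ≡-Reasoning

sumFinℚ-ℕtoℚ : ∀ n (f : Fin n → ℕ) → sumFinℚ n (ℕtoℚ ∘ f) ≡ ℕtoℚ (sumFin n f)
sumFinℚ-ℕtoℚ zero    f = refl
sumFinℚ-ℕtoℚ (suc n) f = trans (cong (ℕtoℚ (f zero) ℚ.+_) (sumFinℚ-ℕtoℚ n (f ∘ suc))) (sym (ℕtoℚ-+ (f zero) _))

floor-mkℚ+ : ∀ a d .(c : Coprime a (suc d)) → floor (mkℚ (ℤ.+ a) d c) ≡ ℤ.+ (a ℕ./ suc d)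
floor-mkℚ+ a d c = ℤP.*-identityˡ (ℤ.+ (a ℕ./ suc d))

floor≡∣floor∣ : ∀ x → 0ℚ ℚ.≤ x → floor x ≡ ℤ.+ ∣ floor x ∣
floor≡∣floor∣ (mkℚ (ℤ.+ a) d c) _ = trans (floor-mkℚ+ a d c) (cong (ℤ.+_ ∘ ∣_∣) (sym (floor-mkℚ+ a d c)))
floor≡∣floor∣ (mkℚ -[1+ a ] d c) 0≤x with ℚ.nonNegative 0≤x
... | ()

floor+frac : ∀ x → 0ℚ ℚ.≤ x → x ≡ ℕtoℚ ∣ floor x ∣ ℚ.+ frac x
floor+frac x 0≤x = sym (begin
  ⌊x⌋ ℚ.+ frac x            ≡⟨ cong (λ z → ⌊x⌋ ℚ.+ (x ℚ.- (z ℚ./ 1))) (floor≡∣floor∣ x 0≤x) ⟩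
  ⌊x⌋ ℚ.+ (x ℚ.- ⌊x⌋)       ≡⟨ cong (⌊x⌋ ℚ.+_) (ℚP.+-comm x (ℚ.- ⌊x⌋)) ⟩
  ⌊x⌋ ℚ.+ (ℚ.- ⌊x⌋ ℚ.+ x)   ≡⟨ sym (ℚP.+-assoc ⌊x⌋ (ℚ.- ⌊x⌋) x) ⟩
  (⌊x⌋ ℚ.- ⌊x⌋) ℚ.+ x       ≡⟨ cong (ℚ._+ x) (ℚP.+-inverseʳ ⌊x⌋) ⟩
  0ℚ ℚ.+ x                  ≡⟨ ℚP.+-identityˡ x ⟩
  x                         ∎)
  where
  open ≡-Reasoning
  ⌊x⌋ = ℕtoℚ ∣ floor x ∣

∣floor-ℕtoℚ∣ : ∀ m → ∣ floor (ℕtoℚ m) ∣ ≡ m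
∣floor-ℕtoℚ∣ m rewrite ℕtoℚ≡mkℚ m = trans (cong ∣_∣ (floor-mkℚ+ m 0 (Coprimality.sym (Coprimality.1-coprimeTo m)))) (n/1≡n m)

sum-of-floors+fracs : ∀ k (f : Fin k → ℚ) (a : Fin k → ℕ) (s N : ℕ) →
  (∀ x → f x ≡ ℕtoℚ (a x) ℚ.+ frac (f x)) → ℕtoℚ s ≡ sumFinℚ k (frac ∘ f) → sumFinℚ k f ≡ ℕtoℚ N →
  sumFin k a + s ≡ N
sum-of-floors+fracs k f a s N f≡a+frac s≡Σfrac Σf≡N = ℕtoℚ-injective _ _ (begin
  ℕtoℚ (sumFin k a + s)                                   ≡⟨ ℕtoℚ-+ (sumFin k a) s ⟩
  ℕtoℚ (sumFin k a) ℚ.+ ℕtoℚ s                            ≡⟨ cong₂ ℚ._+_ (sym (sumFinℚ-ℕtoℚ k a)) s≡Σfrac ⟩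
  sumFinℚ k (ℕtoℚ ∘ a) ℚ.+ sumFinℚ k (frac ∘ f)           ≡⟨ sym (sumFinℚ-+ k _ _) ⟩
  sumFinℚ k (λ x → ℕtoℚ (a x) ℚ.+ frac (f x))             ≡⟨ sumFinℚ-cong k (sym ∘ f≡a+frac) ⟩
  sumFinℚ k f                                             ≡⟨ Σf≡N ⟩
  ℕtoℚ N                                                  ∎)
  where open ≡-Reasoning

floorArray : ∀ {k} → (Fin k → Fin k → Fin k → ℚ) → MultisetArray k
floorArray O i j l = ∣ floor (O i j l) ∣

_∪_ : ∀ {k} → MultisetArray k → MultisetArray k → MultisetArray k
(A ∪ B) i j l = A i j l + B i j l

CoversFractionalParts : ∀ k → (Fin k → Fin k → Fin k → ℚ) → MultisetArray k → Set
CoversFractionalParts k O B =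
  (∀ i j → ℕtoℚ (sumFin k (B i j)) ≡ sumFinℚ k (λ l → frac (O i j l))) ×
  (∀ i j → ℕtoℚ (sumFin k (λ j′ → B i j′ j)) ≡ sumFinℚ k (λ l → frac (O i j l))) ×
  (∀ i j → ℕtoℚ (sumFin k (λ i′ → B i′ i j)) ≡ sumFinℚ k (λ l → frac (O i j l)))

floorArray∪-isOutline : ∀ k h O B → IsRationalOutline k h O → IsSymmetric k O →
  CoversFractionalParts k O B → IsOutline k h (floorArray O ∪ B)
floorArray∪-isOutline k h O B (0≤O , cells , rows , cols) symmetric (cellsB , rowsB , colsB) =
  (λ i j → outline-sum (O i j) (floorArray O i j) (B i j) (split i j) (cellsB i j) (cells i j)) ,
  (λ i l → outline-sum (λ j → O i j l) (λ j → floorArray O i j l) (λ j → B i j l) (λ j → split i j l)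
             (trans (rowsB i l) (sumFinℚ-cong k (λ m → cong frac (sym (O-swap i m l)))))
             (rows i l)) ,
  (λ j l → outline-sum (λ i → O i j l) (λ i → floorArray O i j l) (λ i → B i j l) (λ i → split i j l)
             (trans (colsB j l) (sumFinℚ-cong k (λ m → cong frac (sym (O-cycle m j l)))))
             (cols j l))
  where
  O-swap : ∀ i j l → O i j l ≡ O i l j
  O-swap i j l = proj₁ (proj₂ (symmetric i j l))
  O-cycle : ∀ i j l → O i j l ≡ O j l i
  O-cycle i j l = proj₁ (proj₂ (proj₂ (proj₂ (symmetric i j l))))
  split : ∀ i j l → O i j l ≡ ℕtoℚ (floorArray O i j l) ℚ.+ frac (O i j l)
  split i j l = floor+frac (O i j l) (0≤O i j l)
  outline-sum : ∀ (f : Fin k → ℚ) (a b : Fin k → ℕ) {N} → (∀ x → f x ≡ ℕtoℚ (a x) ℚ.+ frac (f x)) →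
    ℕtoℚ (sumFin k b) ≡ sumFinℚ k (frac ∘ f) → sumFinℚ k f ≡ ℕtoℚ N → sumFin k (λ x → a x + b x) ≡ N
  outline-sum f a b f≡a+frac Σb≡Σfrac Σf≡N =
    trans (sumFin-+ k a b) (sum-of-floors+fracs k f a (sumFin k b) _ f≡a+frac Σb≡Σfrac Σf≡N)

floorArray∪-diagonal : ∀ k h O B → IsOutline k h (floorArray O ∪ B) → (∀ i → O i i i ≡ ℕtoℚ (h i * h i)) →
  ∀ i → (floorArray O ∪ B) i i i ≡ h i * h i
floorArray∪-diagonal k h O B (cells , _) diagonal i = ≤-antisym
  (subst ((floorArray O ∪ B) i i i ≤_) (cells i i) (term≤sumFin k ((floorArray O ∪ B) i i) i))
  (subst (_≤ (floorArray O ∪ B) i i i) (trans (cong (∣_∣ ∘ floor) (diagonal i)) (∣floor-ℕtoℚ∣ (h i * h i)))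
    (m≤m+n _ (B i i i)))

-- Subsquares from a pure diagonal

module PureDiagonal k (h : Fin k → ℕ) (C : MultisetArray k) (outline : IsOutline k h C)
                    (diagonal : ∀ i → C i i i ≡ h i * h i) where

  cell-pure : ∀ i l → l ≢ i → C i i l ≡ 0
  cell-pure i = sumFin≡term⇒≡0 k (C i i) i (trans (proj₁ outline i i) (sym (diagonal i)))

  row-pure : ∀ i j → j ≢ i → C i j i ≡ 0
  row-pure i = sumFin≡term⇒≡0 k (λ j → C i j i) i (trans (proj₁ (proj₂ outline) i i) (sym (diagonal i)))

  column-pure : ∀ i j → j ≢ i → C j i i ≡ 0
  column-pure i = sumFin≡term⇒≡0 k (λ j → C j i i) i (trans (proj₂ (proj₂ outline) i i) (sym (diagonal i)))

module BlockSubsquares k (h : Fin k → ℕ) (C : MultisetArray k) (outline : IsOutline k h C)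
    (diagonal : ∀ i → C i i i ≡ h i * h i)
    (L : Fin (sumFin k h) → Fin (sumFin k h) → Fin (sumFin k h)) (latin : IsLatin (sumFin k h) L)
    (lifts : LiftsTo (sumFin k h) k h C L) where

  open BlockStructure k h
  open PureDiagonal k h C outline diagonal

  _∈_ : Fin n → Fin k → Set
  x ∈ i = inBlock k h i x ≡ true

  lifted-zero : ∀ {i j l r c} → C i j l ≡ 0 → r ∈ i → c ∈ j → L r c ∈ l → ⊥
  lifted-zero {i} {j} {l} {r} {c} C≡0 r∈i c∈j Lrc∈l = 1+n≢0 (trans (sym term≡1) term≡0)
    where
    term : ℕ
    term = if inBlock k h i r ∧ inBlock k h j c ∧ inBlock k h l (L r c) then 1 else 0
    term≡0 : term ≡ 0
    term≡0 = sumFin≡0⇒≡0 n _ (sumFin≡0⇒≡0 n _ (trans (lifts i j l) C≡0) r) c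
    term≡1 : term ≡ 1
    term≡1 rewrite r∈i | c∈j | Lrc∈l = refl

  in-block-by-elimination : ∀ x i → (∀ j → j ≢ i → x ∈ j → ⊥) → x ∈ i
  in-block-by-elimination x i not-elsewhere with blockOf x F.≟ i
  ... | yes refl = inBlock-blockOf x
  ... | no  b≢i  = ⊥-elim (not-elsewhere (blockOf x) b≢i (inBlock-blockOf x))

  symbol-in-block : ∀ {i r c} → r ∈ i → c ∈ i → L r c ∈ i
  symbol-in-block {i} r∈i c∈i =
    in-block-by-elimination _ i (λ l l≢i → lifted-zero (cell-pure i l l≢i) r∈i c∈i)

  column-in-block : ∀ {i r c} → r ∈ i → L r c ∈ i → c ∈ i
  column-in-block {i} r∈i Lrc∈i =
    in-block-by-elimination _ i (λ j j≢i c∈j → lifted-zero (row-pure i j j≢i) r∈i c∈j Lrc∈i)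

  row-in-block : ∀ {i r c} → c ∈ i → L r c ∈ i → r ∈ i
  row-in-block {i} c∈i Lrc∈i =
    in-block-by-elimination _ i (λ j j≢i r∈j → lifted-zero (column-pure i j j≢i) r∈j c∈i Lrc∈i)

  sub : ∀ i → Fin (h i) → Fin (h i) → Fin (h i)
  sub i a b = index i (L (member i a) (member i b)) (symbol-in-block (inBlock-member i a) (inBlock-member i b))

  member-sub : ∀ i a b → member i (sub i a b) ≡ L (member i a) (member i b)
  member-sub i a b = member-index i _ _

  sub-latin : ∀ i → IsLatin (h i) (sub i)
  sub-latin i = rows , cols
    where
    rows : ∀ a t → Σ (Fin (h i)) λ b → sub i a b ≡ t × (∀ b′ → sub i a b′ ≡ t → b′ ≡ b)
    rows a t with proj₁ latin (member i a) (member i t)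
    ... | c , Lc≡t , unique = b , member-injective i member-sub≡ , λ b′ sub≡t →
      member-injective i (trans (unique (member i b′) (trans (sym (member-sub i a b′)) (cong (member i) sub≡t)))
                                (sym member-b))
      where
      c∈i : c ∈ i
      c∈i = column-in-block (inBlock-member i a) (subst (_∈ i) (sym Lc≡t) (inBlock-member i t))
      b = index i c c∈i
      member-b : member i b ≡ c
      member-b = member-index i c c∈i
      member-sub≡ : member i (sub i a b) ≡ member i t
      member-sub≡ = trans (member-sub i a b) (trans (cong (L (member i a)) member-b) Lc≡t)
    cols : ∀ b t → Σ (Fin (h i)) λ a → sub i a b ≡ t × (∀ a′ → sub i a′ b ≡ t → a′ ≡ a)
    cols b t with proj₂ latin (member i b) (member i t)
    ... | r , Lr≡t , unique = a , member-injective i member-sub≡ , λ a′ sub≡t →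
      member-injective i (trans (unique (member i a′) (trans (sym (member-sub i a′ b)) (cong (member i) sub≡t)))
                                (sym member-a))
      where
      r∈i : r ∈ i
      r∈i = row-in-block (inBlock-member i b) (subst (_∈ i) (sym Lr≡t) (inBlock-member i t))
      a = index i r r∈i
      member-a : member i a ≡ r
      member-a = member-index i r r∈i
      member-sub≡ : member i (sub i a b) ≡ member i t
      member-sub≡ = trans (member-sub i a b) (trans (cong (λ x → L x (member i b)) member-a) Lr≡t)

  subsquare : (i : Fin k) → Subsquare n L (h i)
  subsquare i = record
    { rows = member i ; cols = member i ; syms = member i
    ; rowsInj = member-injective i ; colsInj = member-injective i ; symsInj = member-injective i
    ; sub = sub i ; subLatin = sub-latin i ; subEq = λ a b → sym (member-sub i a b) }

  disjoint : ∀ i j → i ≢ j → Disjoint (subsquare i) (subsquare j)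
  disjoint i j i≢j = different , different , different
    where
    different : ∀ a b → member i a ≢ member j b
    different a b eq = i≢j (trans (sym (blockOf-unique i _ (inBlock-member i a)))
                                  (blockOf-unique j _ (subst (_∈ j) (sym eq) (inBlock-member j b))))

  realization : IsLSRealization n k h L
  realization = latin , subsquare , disjoint

pure-diagonal-outline-realizes : ∀ k (h : Fin k → ℕ) (C : MultisetArray k) → IsOutline k h C →
  (∀ i → C i i i ≡ h i * h i) →
  Σ (Fin (sumFin k h) → Fin (sumFin k h) → Fin (sumFin k h)) λ L →
    IsLSRealization (sumFin k h) k h L × LiftsTo (sumFin k h) k h C L
pure-diagonal-outline-realizes k h C outline diagonal =
  let L , latin , lifts = outline-lifts k h C outline
  in L , BlockSubsquares.realization k h C outline diagonal L latin lifts , lifts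

mainTheorem2 : (n k : ℕ) (h : Fin k → ℕ) → IsPartition n k h →
  (O : Fin k → Fin k → Fin k → ℚ) → IsRationalOutline k h O → IsSymmetric k O →
  (∀ i → O i i i ≡ ℕtoℚ (h i * h i)) →
  (B : MultisetArray k) →
  (∀ i j → ℕtoℚ (sumFin k (B i j)) ≡ sumFinℚ k (λ l → frac (O i j l))) →
  (∀ i j → ℕtoℚ (sumFin k (λ j′ → B i j′ j)) ≡ sumFinℚ k (λ l → frac (O i j l))) →
  (∀ i j → ℕtoℚ (sumFin k (λ i′ → B i′ i j)) ≡ sumFinℚ k (λ l → frac (O i j l))) →
  let A : MultisetArray k
      A i j l = ∣ floor (O i j l) ∣
      C : MultisetArray k
      C i j l = A i j l + B i j l
  in IsOutline k h C ×
     (∀ i → C i i i ≡ h i * h i) × (∀ i l → l ≢ i → C i i l ≡ 0) ×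
     Σ (Fin n → Fin n → Fin n) (λ L → IsLSRealization n k h L × LiftsTo n k h C L)
mainTheorem2 n k h (_ , _ , refl) O rational symmetric diagonalO B cellsB rowsB colsB =
  outline , diagonal , PureDiagonal.cell-pure k h C outline diagonal ,
  pure-diagonal-outline-realizes k h C outline diagonal
  where
  C : MultisetArray k
  C = floorArray O ∪ B
  outline : IsOutline k h C
  outline = floorArray∪-isOutline k h O B rational symmetric (cellsB , rowsB , colsB)
  diagonal : ∀ i → C i i i ≡ h i * h i
  diagonal = floorArray∪-diagonal k h O B outline diagonalO
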